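{- The map $\theta$ defined below is a bijection from the set of pairs $(t,\tau)$, with $t$ a plane rooted tree with $n$ vertices and $\tau$ a binary tubing of $t$, to the set of rooted connected chord diagrams with $n$ chords.
   Context: A plane rooted tree is a root with an ordered list of plane rooted trees as children. A tube is a vertex set inducing a connected subgraph; a binary tubing $\tau$ of $t$ is a set of tubes containing $V(t)$ such that each tube is a single vertex or is partitioned by two other tubes of $\tau$. If $t$ has $\ge2$ vertices, the two tubes partitioning $V(t)$ are the vertex set of a rooted subtree $t'$ (some non-root vertex and all its descendants) and of $t''=t\setminus t'$ (containing the root); $\tau$ restricts to tubings $\tau',\tau''$ of $t',t''$, and $\tau$ is determined by $(\tau',\tau'')$ and the position where $t'$ is attached. Rooted tree insertion places (RTIPs) of a plane rooted tree: at each vertex, a place before the first child, between consecutive children, and after the last child (a leaf has one). They are ordered recursively: for root with subtrees $t_1,\dots,t_k$: the place before $t_1$, then the places of $t_1$ in order, the place between $t_1,t_2$, the places of $t_2$, ..., the place after $t_k$. Let $x_i$ be the $i$-th RTIP; $t$ is obtained from $t''$ by attaching the root of $t'$ as a child at some RTIP $x_i$ of $t''$. A rooted chord diagram of size $n$ is a set of pairs $(a_j,b_j)$, $a_j<b_j$, partitioning $\{1,\dots,2n\}$; the root chord is the one with $a_j=1$. Two chords $(a,b),(a',b')$ cross if $a<a'<b<b'$ or $a'<a<b'<b$; a diagram is connected if its crossing graph is connected. Definition of $\theta$: if $t$ is one vertex, $\theta(\tau)$ is the one-chord diagram. Otherwise let $C''=\theta(\tau'')$ (size $n''$) and $C'=\theta(\tau')$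 (size $m$, root chord $(1,k)$), and let $i$ be such that $t'$ is attached at the $i$-th RTIP of $t''$. Then $\theta(\tau)$ has points $\{1,\dots,2n''+2m\}$ and chords: $(1,k+i)$; $(a+i,b+i)$ for each non-root chord $(a,b)$ of $C'$; and for each chord of $C''$, each endpoint $p$ becomes $p+1$ if $p\le i$ and $p+2m$ if $p>i$. -}

module Defs where

open import Data.Nat using (ℕ; zero; suc; _+_; _*_; _∸_; _<_; _≤_; _≤ᵇ_; _<ᵇ_; _≡ᵇ_)
open import Data.Bool using (Bool; true; false; if_then_else_)
open import Data.Fin using (Fin; toℕ)
open import Data.List using (List; []; _∷_; _++_; map; filter; length; upTo; concatMap)
open import Data.List.Membership.Propositional using (_∈_)
open import Data.List.Relation.Unary.All using (All)
open import Data.List.Relation.Binary.Permutation.Propositional using (_↭_)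
open import Data.Product using (_×_; _,_; proj₁; proj₂)
open import Data.Sum using (_⊎_)

data PTree : Set where
  node : List PTree → PTree

mutual
  size : PTree → ℕ
  size (node cs) = suc (sizeL cs)

  sizeL : List PTree → ℕ
  sizeL []       = 0
  sizeL (c ∷ cs) = size c + sizeL cs

mutual
  -- number of rooted tree insertion places (RTIPs)
  -- (at each vertex: #children + 1 places)
  places : PTree → ℕ
  places (node cs) = placesL cs

  -- places of a root whose children are the given list, in RTIP order:
  -- place before first child, places of that child, place between, ...,
  -- place after last child.
  placesL : List PTree → ℕ
  placesL []       = 1
  placesL (c ∷ cs) = suc (places c + placesL cs)

mutual
  -- insert t s j : attach the root of s as a child at the RTIP of t with
  -- 0-based index j (i.e. the (j+1)-th RTIP, x_{j+1}) in the recursive order.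
  insert : PTree → ℕ → PTree → PTree
  insert (node cs) j s = node (insertL cs j s)

  insertL : List PTree → ℕ → PTree → List PTree
  insertL []       _       s = s ∷ []
  insertL (c ∷ cs) zero    s = s ∷ c ∷ cs
  insertL (c ∷ cs) (suc j) s =
    if j <ᵇ places c then insert c j s ∷ cs
    else c ∷ insertL cs (j ∸ places c) s

-- Binary tubings of a plane rooted tree t, described by their recursive
-- decomposition: a one-vertex tree has its unique tubing; otherwise V(t)
-- is partitioned into the tubes V(t') (a rooted subtree) and V(t'')
-- (containing the root), τ restricts to tubings τ', τ'' of t', t'', and
-- τ is determined by (τ', τ'') and the RTIP of t'' where t' is attached.

leaf : PTree
leaf = node []

data Tubing : PTree → Set where
  single : Tubing leaf
  join   : {t' t'' : PTree} → Tubing t' → Tubing t'' →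
           (j : Fin (places t'')) → Tubing (insert t'' (toℕ j) t')

-- Chord diagrams: a finite set of chords (a , b), represented by a list
-- considered up to permutation.

Chord : Set
Chord = ℕ × ℕ

endpoints : List Chord → List ℕ
endpoints = concatMap (λ c → proj₁ c ∷ proj₂ c ∷ [])

IsChordDiagram : ℕ → List Chord → Set
IsChordDiagram n C =
  All (λ c → proj₁ c < proj₂ c) C × (endpoints C ↭ map suc (upTo (2 * n)))

Cross : Chord → Chord → Set
Cross (a , b) (a' , b') =
  (a < a' × a' < b × b < b') ⊎ (a' < a × a < b' × b' < b)

data Path (C : List Chord) : Chord → Chord → Set where
  here : ∀ {c} → Path C c c
  step : ∀ {c d e} → d ∈ C → Cross c d → Path C d e → Path C c e

Connected : List Chord → Set
Connected C = ∀ {c d} → c ∈ C → d ∈ C → Path C c d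

-- rooted connected chord diagram with n chords (the root chord is the one
-- with a = 1, so it is determined by C)
IsRootedConnectedCD : ℕ → List Chord → Set
IsRootedConnectedCD n C = IsChordDiagram n C × Connected C

rootEnd : List Chord → ℕ
rootEnd []             = 0
rootEnd ((a , b) ∷ cs) = if a ≡ᵇ 1 then b else rootEnd cs

nonRoot : List Chord → List Chord
nonRoot []             = []
nonRoot ((a , b) ∷ cs) = if a ≡ᵇ 1 then nonRoot cs else (a , b) ∷ nonRoot cs

θ : {t : PTree} → Tubing t → List Chord
θ single = (1 , 2) ∷ []
θ (join τ' τ'' j) =
  (1 , k + i) ∷ map (λ c → (proj₁ c + i , proj₂ c + i)) (nonRoot C')
              ++ map (λ c → (sh (proj₁ c) , sh (proj₂ c))) C''
  where
    C'  = θ τ'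
    C'' = θ τ''
    m   = length C'
    k   = rootEnd C'
    i   = suc (toℕ j)          -- t' is attached at the i-th RTIP (1-based)
    sh : ℕ → ℕ
    sh p = if p ≤ᵇ i then suc p else p + 2 * m

-- θ (join τ' τ'' j) consists of a new root chord (1 , k + i), the other chords of θ τ' moved
-- into the window (i + 1 , i + 2m], and the chords of θ τ'' with that window opened at i. It is a
-- connected diagram because some chord of θ τ'' jumps over i and so crosses the new root chord.
-- Inside it, the chords coming from θ τ'' are the crossing component, among non-root chords, of
-- the chord starting at 2; they occupy exactly the points outside the window, so i, m and both
-- halves can be read off, which gives injectivity. Conversely, for a connected diagram C with
-- n ≥ 2 chords let S be that component and e₁ < R < e₂ the endpoints of S closest to the root
-- end R. Every other non-root chord lies strictly between e₁ and e₂. Closing the gap in S, and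
-- moving the root chord together with the chords inside the gap down to 1 … e₂ − e₁, gives two
-- smaller connected diagrams; by induction on n their preimages, joined at i = e₁ − 1, form a
-- preimage of C.

module Submission where

open import Defs
open import Data.Bool using (true; false; if_then_else_; T)
open import Data.Empty using (⊥; ⊥-elim)
open import Data.Fin using (Fin; toℕ; fromℕ<)
open import Data.Fin.Properties using (toℕ<n; toℕ-injective; toℕ-fromℕ<)
open import Data.List using (List; []; _∷_; _++_; map; length; upTo; applyUpTo)
open import Data.List.Properties using (length-map; length-++; map-++; ++-assoc; map-applyUpTo)
open import Data.List.Membership.Propositional using (_∈_; _∉_; find; lose)
open import Data.List.Membership.Propositional.Properties
  using (∈-map⁺; ∈-map⁻; ∈-++⁺ˡ; ∈-++⁺ʳ; ∈-++⁻; ∈-∃++)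
open import Data.List.Membership.Propositional.Properties.WithK using (unique∧set⇒bag)
open import Data.List.Relation.Binary.BagAndSetEquality using (∼bag⇒↭)
open import Data.List.Relation.Binary.Permutation.Propositional
  using (_↭_; ↭-sym; ↭-trans; ↭-reflexive; ↭⇒↭ₛ)
  renaming (refl to ↭refl; prep to ↭prep; swap to ↭swap; trans to ↭trans)
open import Data.List.Relation.Binary.Permutation.Propositional.Properties
  using (∈-resp-↭; ↭-length; ++⁺; ++⁺ˡ; shift; shifts; drop-∷)
  renaming (map⁺ to ↭-map⁺)
import Data.List.Relation.Binary.Permutation.Setoid.Properties as Permutationₛ
open import Data.List.Relation.Unary.All as All using (All; []; _∷_; tabulate)
import Data.List.Relation.Unary.All.Properties as Allₚ
open import Data.List.Relation.Unary.Any using (here; there; any?)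
open import Data.List.Relation.Unary.Unique.Propositional using (Unique; []; _∷_)
open import Data.List.Relation.Unary.Unique.Propositional.Properties using (Unique[x∷xs]⇒x∉xs)
open import Data.Nat
open import Data.Nat.Induction using (<-rec)
open import Data.Nat.Properties
open import Data.Nat.Tactic.RingSolver using (solve-∀)
open import Data.List.Membership.DecPropositional _≟_ using (_∈?_)
open import Data.Product as Product using (Σ; _×_; _,_; ∃; proj₁; proj₂)
open import Data.Sum as Sum using (_⊎_; inj₁; inj₂)
open import Data.Unit using (⊤; tt)
open import Function using (_∘_; id)
open import Function.Bundles using (mk⇔)
open import Relation.Binary.Definitions using (tri<; tri≈; tri>)
open import Relation.Binary.PropositionalEquality
  using (module ≡-Reasoning; _≡_; _≢_; refl; sym; trans; cong; cong₂; subst; subst₂; setoid)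
open import Relation.Nullary using (¬_; Dec; yes; no)
open import Relation.Nullary.Decidable using (_×-dec_; _⊎-dec_)

module _ {A : Set} where

  unique-resp-↭ : {xs ys : List A} → xs ↭ ys → Unique xs → Unique ys
  unique-resp-↭ p = Permutationₛ.Unique-resp-↭ (setoid A) (↭⇒↭ₛ p)

  unique-set⇒↭ : {xs ys : List A} → Unique xs → Unique ys →
                 (∀ {x} → x ∈ xs → x ∈ ys) → (∀ {x} → x ∈ ys → x ∈ xs) → xs ↭ ys
  unique-set⇒↭ ux uy xs⊆ys ys⊆xs = ∼bag⇒↭ (unique∧set⇒bag ux uy (mk⇔ xs⊆ys ys⊆xs))

  unique-++⁻ˡ : ∀ xs {ys : List A} → Unique (xs ++ ys) → Unique xs
  unique-++⁻ˡ []       _        = []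
  unique-++⁻ˡ (x ∷ xs) (px ∷ u) = Allₚ.++⁻ˡ xs px ∷ unique-++⁻ˡ xs u

  unique-++⁻ʳ : ∀ xs {ys : List A} → Unique (xs ++ ys) → Unique ys
  unique-++⁻ʳ []       u       = u
  unique-++⁻ʳ (x ∷ xs) (_ ∷ u) = unique-++⁻ʳ xs u

  unique-++-disjoint : ∀ xs {ys : List A} {x} → Unique (xs ++ ys) → x ∈ xs → x ∉ ys
  unique-++-disjoint (x ∷ xs) u (here refl) = Unique[x∷xs]⇒x∉xs u ∘ ∈-++⁺ʳ xs
  unique-++-disjoint (x ∷ xs) (_ ∷ u) (there x∈xs) = unique-++-disjoint xs u x∈xs

module _ {A B : Set} (f : A → B) where

  unique-map⁺ : ∀ {xs : List A} → (∀ {x y} → x ∈ xs → y ∈ xs → f x ≡ f y → x ≡ y) →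
                Unique xs → Unique (map f xs)
  unique-map⁺ {[]}     _   []       = []
  unique-map⁺ {x ∷ xs} inj (px ∷ u) =
    tabulate fx≢ ∷ unique-map⁺ (λ p q → inj (there p) (there q)) u
    where
    fx≢ : ∀ {z} → z ∈ map f xs → f x ≢ z
    fx≢ z∈ fx≡z with ∈-map⁻ f z∈
    ... | y , y∈ , refl = All.lookup px y∈ (inj (here refl) (there y∈) fx≡z)

range : ℕ → ℕ → List ℕ
range a zero    = []
range a (suc n) = a ∷ range (suc a) n

∈-range⁻ : ∀ {a n p} → p ∈ range a n → a ≤ p × p < a + n
∈-range⁻ {a} {suc n} (here refl) = ≤-refl , m<m+n a z<s
∈-range⁻ {a} {suc n} {p} (there p∈) with ∈-range⁻ {suc a} {n} p∈
... | a<p , p<a+n = <⇒≤ a<p , subst (p <_) (sym (+-suc a n)) p<a+n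

∈-range⁺ : ∀ {a n p} → a ≤ p → p < a + n → p ∈ range a n
∈-range⁺ {a} {zero}  a≤p p<a+0 = ⊥-elim (<⇒≱ p<a+0 (subst (_≤ _) (sym (+-identityʳ a)) a≤p))
∈-range⁺ {a} {suc n} {p} a≤p p<a+n with m≤n⇒m<n∨m≡n a≤p
... | inj₂ refl = here refl
... | inj₁ a<p  = there (∈-range⁺ a<p (subst (p <_) (+-suc a n) p<a+n))

range-unique : ∀ a n → Unique (range a n)
range-unique a zero    = []
range-unique a (suc n) = tabulate (λ p∈ → <⇒≢ (proj₁ (∈-range⁻ p∈))) ∷ range-unique (suc a) n

length-range : ∀ a n → length (range a n) ≡ n
length-range a zero    = refl
length-range a (suc n) = cong suc (length-range (suc a) n)

range-++ : ∀ a x y → range a (x + y) ≡ range a x ++ range (a + x) y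
range-++ a zero    y = cong (λ b → range b y) (sym (+-identityʳ a))
range-++ a (suc x) y = cong (a ∷_) (trans (range-++ (suc a) x y)
  (cong (λ b → range (suc a) x ++ range b y) (sym (+-suc a x))))

map-range : ∀ (f : ℕ → ℕ) a n b → (∀ x → x < n → f (a + x) ≡ b + x) → map f (range a n) ≡ range b n
map-range f a zero    b _  = refl
map-range f a (suc n) b fx = cong₂ _∷_
  (trans (cong f (sym (+-identityʳ a))) (trans (fx 0 z<s) (+-identityʳ b)))
  (map-range f (suc a) n (suc b)
    (λ x x<n → trans (cong f (sym (+-suc a x))) (trans (fx (suc x) (s<s x<n)) (+-suc b x))))

applyUpTo-range : ∀ (f : ℕ → ℕ) a n → (∀ x → f x ≡ a + x) → applyUpTo f n ≡ range a n
applyUpTo-range f a zero    _  = refl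
applyUpTo-range f a (suc n) fx = cong₂ _∷_ (trans (fx 0) (+-identityʳ a))
  (applyUpTo-range (f ∘ suc) (suc a) n (λ x → trans (fx (suc x)) (+-suc a x)))

map-suc-upTo : ∀ n → map suc (upTo n) ≡ range 1 n
map-suc-upTo n = trans (map-applyUpTo id suc n) (applyUpTo-range suc 1 n (λ _ → refl))

-- Chord diagrams

mapChord : (ℕ → ℕ) → Chord → Chord
mapChord f c = f (proj₁ c) , f (proj₂ c)

infix 4 _∈ᶜ_
_∈ᶜ_ : ℕ → Chord → Set
p ∈ᶜ c = p ≡ proj₁ c ⊎ p ≡ proj₂ c

endpoints-++ : ∀ (xs : List Chord) ys → endpoints (xs ++ ys) ≡ endpoints xs ++ endpoints ys
endpoints-++ []       ys = refl
endpoints-++ (x ∷ xs) ys = cong (λ l → proj₁ x ∷ proj₂ x ∷ l) (endpoints-++ xs ys)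

endpoints-map : ∀ f (xs : List Chord) → endpoints (map (mapChord f) xs) ≡ map f (endpoints xs)
endpoints-map f []       = refl
endpoints-map f (x ∷ xs) = cong (λ l → f (proj₁ x) ∷ f (proj₂ x) ∷ l) (endpoints-map f xs)

endpoints-↭ : ∀ {xs ys : List Chord} → xs ↭ ys → endpoints xs ↭ endpoints ys
endpoints-↭ ↭refl         = ↭refl
endpoints-↭ (↭prep x p)   = ↭prep _ (↭prep _ (endpoints-↭ p))
endpoints-↭ (↭swap x y p) =
  ↭-trans (shifts (proj₁ x ∷ proj₂ x ∷ []) (proj₁ y ∷ proj₂ y ∷ []))
    (++⁺ˡ (proj₁ y ∷ proj₂ y ∷ []) (++⁺ˡ (proj₁ x ∷ proj₂ x ∷ []) (endpoints-↭ p)))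
endpoints-↭ (↭trans p q)  = ↭-trans (endpoints-↭ p) (endpoints-↭ q)

length-endpoints : ∀ (xs : List Chord) → length (endpoints xs) ≡ 2 * length xs
length-endpoints []       = refl
length-endpoints (x ∷ xs) =
  cong suc (trans (cong suc (length-endpoints xs)) (sym (+-suc (length xs) (length xs + 0))))

∈-endpoints⁻ : ∀ {p} (xs : List Chord) → p ∈ endpoints xs → ∃ λ c → c ∈ xs × p ∈ᶜ c
∈-endpoints⁻ (x ∷ xs) (here refl)         = x , here refl , inj₁ refl
∈-endpoints⁻ (x ∷ xs) (there (here refl)) = x , here refl , inj₂ refl
∈-endpoints⁻ (x ∷ xs) (there (there p∈)) with ∈-endpoints⁻ xs p∈
... | c , c∈ , p∈c = c , there c∈ , p∈c

∈-endpoints⁺ : ∀ {p c} {xs : List Chord} → c ∈ xs → p ∈ᶜ c → p ∈ endpoints xs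
∈-endpoints⁺ (here refl) (inj₁ refl) = here refl
∈-endpoints⁺ (here refl) (inj₂ refl) = there (here refl)
∈-endpoints⁺ (there c∈) p∈c          = there (there (∈-endpoints⁺ c∈ p∈c))

head-endpoint-fresh : ∀ {x xs p} → Unique (endpoints (x ∷ xs)) → p ∈ᶜ x → p ∉ endpoints xs
head-endpoint-fresh u       (inj₁ refl) p∈ = Unique[x∷xs]⇒x∉xs u (there p∈)
head-endpoint-fresh (_ ∷ u) (inj₂ refl) p∈ = Unique[x∷xs]⇒x∉xs u p∈

chord-determined-by-endpoint : ∀ {xs : List Chord} → Unique (endpoints xs) →
  ∀ {c d p} → c ∈ xs → d ∈ xs → p ∈ᶜ c → p ∈ᶜ d → c ≡ d
chord-determined-by-endpoint u (here refl) (here refl) _ _ = refl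
chord-determined-by-endpoint {_ ∷ xs} u (here refl) (there d∈) p∈x p∈d =
  ⊥-elim (head-endpoint-fresh {xs = xs} u p∈x (∈-endpoints⁺ d∈ p∈d))
chord-determined-by-endpoint {_ ∷ xs} u (there c∈) (here refl) p∈c p∈x =
  ⊥-elim (head-endpoint-fresh {xs = xs} u p∈x (∈-endpoints⁺ c∈ p∈c))
chord-determined-by-endpoint (_ ∷ _ ∷ u) (there c∈) (there d∈) p∈c p∈d =
  chord-determined-by-endpoint u c∈ d∈ p∈c p∈d

unique-endpoints⇒unique : ∀ {xs : List Chord} → Unique (endpoints xs) → Unique xs
unique-endpoints⇒unique {[]}     _            = []
unique-endpoints⇒unique {x ∷ xs} (_ ∷ pb ∷ u) =
  tabulate (λ y∈ x≡y → All.lookup pb (∈-endpoints⁺ y∈ (inj₂ (cong proj₂ x≡y))) refl)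
  ∷ unique-endpoints⇒unique u

≢1⇒≡ᵇ1-false : ∀ {a} → a ≢ 1 → (a ≡ᵇ 1) ≡ false
≢1⇒≡ᵇ1-false {zero}        _   = refl
≢1⇒≡ᵇ1-false {suc zero}    a≢1 = ⊥-elim (a≢1 refl)
≢1⇒≡ᵇ1-false {suc (suc a)} _   = refl

nonRoot-∷ : ∀ {a b} xs → a ≢ 1 → nonRoot ((a , b) ∷ xs) ≡ (a , b) ∷ nonRoot xs
nonRoot-∷ xs a≢1 rewrite ≢1⇒≡ᵇ1-false a≢1 = refl

rootEnd-∷ : ∀ {a b} xs → a ≢ 1 → rootEnd ((a , b) ∷ xs) ≡ rootEnd xs
rootEnd-∷ xs a≢1 rewrite ≢1⇒≡ᵇ1-false a≢1 = refl

∈-nonRoot⁻ : ∀ {x} (xs : List Chord) → x ∈ nonRoot xs → x ∈ xs × proj₁ x ≢ 1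
∈-nonRoot⁻ ((a , b) ∷ xs) x∈ with a ≟ 1
... | yes refl = Product.map₁ there (∈-nonRoot⁻ xs x∈)
... | no a≢1 with subst (_ ∈_) (nonRoot-∷ xs a≢1) x∈
...   | here refl = here refl , a≢1
...   | there x∈′ = Product.map₁ there (∈-nonRoot⁻ xs x∈′)

∈-nonRoot⁺ : ∀ {x} (xs : List Chord) → x ∈ xs → proj₁ x ≢ 1 → x ∈ nonRoot xs
∈-nonRoot⁺ ((a , b) ∷ xs) x∈ x≢1 with a ≟ 1
∈-nonRoot⁺ ((a , b) ∷ xs) (here refl) x≢1 | yes refl = ⊥-elim (x≢1 refl)
∈-nonRoot⁺ ((a , b) ∷ xs) (there x∈) x≢1 | yes refl = ∈-nonRoot⁺ xs x∈ x≢1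
∈-nonRoot⁺ ((a , b) ∷ xs) (here refl) x≢1 | no a≢1 =
  subst (_ ∈_) (sym (nonRoot-∷ xs a≢1)) (here refl)
∈-nonRoot⁺ ((a , b) ∷ xs) (there x∈) x≢1 | no a≢1 =
  subst (_ ∈_) (sym (nonRoot-∷ xs a≢1)) (there (∈-nonRoot⁺ xs x∈ x≢1))

nonRoot-unique : ∀ {xs : List Chord} → Unique xs → Unique (nonRoot xs)
nonRoot-unique {[]}           []       = []
nonRoot-unique {(a , b) ∷ xs} (px ∷ u) with a ≟ 1
... | yes refl = nonRoot-unique u
... | no a≢1   = subst Unique (sym (nonRoot-∷ xs a≢1))
  (tabulate (λ y∈ → All.lookup px (proj₁ (∈-nonRoot⁻ xs y∈))) ∷ nonRoot-unique u)

rootEnd-∈ : ∀ (xs : List Chord) {c} → c ∈ xs → proj₁ c ≡ 1 → (1 , rootEnd xs) ∈ xs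
rootEnd-∈ ((a , b) ∷ xs) c∈ c₁≡1 with a ≟ 1
rootEnd-∈ ((a , b) ∷ xs) c∈          c₁≡1 | yes refl = here refl
rootEnd-∈ ((a , b) ∷ xs) (here refl) c₁≡1 | no a≢1  = ⊥-elim (a≢1 c₁≡1)
rootEnd-∈ ((a , b) ∷ xs) (there c∈)  c₁≡1 | no a≢1  =
  subst (λ r → (1 , r) ∈ (a , b) ∷ xs) (sym (rootEnd-∷ xs a≢1)) (there (rootEnd-∈ xs c∈ c₁≡1))

DiagramOn : ℕ → List Chord → Set
DiagramOn L C = All (λ c → proj₁ c < proj₂ c) C × (endpoints C ↭ range 1 L)

isChordDiagram⇒diagramOn : ∀ {n C} → IsChordDiagram n C → DiagramOn (2 * n) C
isChordDiagram⇒diagramOn {n} (ordered , perm) = ordered , subst (_ ↭_) (map-suc-upTo (2 * n)) perm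

diagramOn⇒isChordDiagram : ∀ {n C} → DiagramOn (2 * n) C → IsChordDiagram n C
diagramOn⇒isChordDiagram {n} (ordered , perm) = ordered , subst (_ ↭_) (sym (map-suc-upTo (2 * n))) perm

module Diagram {L : ℕ} {C : List Chord} (D : DiagramOn L C) where

  endpoints-unique : Unique (endpoints C)
  endpoints-unique = unique-resp-↭ (↭-sym (proj₂ D)) (range-unique 1 L)

  unique : Unique C
  unique = unique-endpoints⇒unique endpoints-unique

  start<end : ∀ {c} → c ∈ C → proj₁ c < proj₂ c
  start<end = All.lookup (proj₁ D)

  endpoint-bounds : ∀ {p} → p ∈ endpoints C → 1 ≤ p × p ≤ L
  endpoint-bounds p∈ = Product.map₂ ≤-pred (∈-range⁻ (∈-resp-↭ (proj₂ D) p∈))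

  start≥1 : ∀ {c} → c ∈ C → 1 ≤ proj₁ c
  start≥1 c∈ = proj₁ (endpoint-bounds (∈-endpoints⁺ c∈ (inj₁ refl)))

  end≤ : ∀ {c} → c ∈ C → proj₂ c ≤ L
  end≤ c∈ = proj₂ (endpoint-bounds (∈-endpoints⁺ c∈ (inj₂ refl)))

  chord-at : ∀ {p} → 1 ≤ p → p ≤ L → ∃ λ c → c ∈ C × p ∈ᶜ c
  chord-at 1≤p p≤L = ∈-endpoints⁻ C (∈-resp-↭ (↭-sym (proj₂ D)) (∈-range⁺ 1≤p (s≤s p≤L)))

  2*length : 2 * length C ≡ L
  2*length = trans (sym (length-endpoints C)) (trans (↭-length (proj₂ D)) (length-range 1 L))

  same-chord : ∀ {c d p} → c ∈ C → d ∈ C → p ∈ᶜ c → p ∈ᶜ d → c ≡ d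
  same-chord = chord-determined-by-endpoint endpoints-unique

  root∈ : 1 ≤ L → (1 , rootEnd C) ∈ C
  root∈ 1≤L with chord-at ≤-refl 1≤L
  ... | c , c∈ , inj₁ 1≡c₁ = rootEnd-∈ C c∈ (sym 1≡c₁)
  ... | c , c∈ , inj₂ 1≡c₂ =
    ⊥-elim (<⇒≱ (start<end c∈) (≤-trans (≤-reflexive (sym 1≡c₂)) (start≥1 c∈)))

  root-unique : 1 ≤ L → ∀ {c} → c ∈ C → proj₁ c ≡ 1 → c ≡ (1 , rootEnd C)
  root-unique 1≤L c∈ c₁≡1 = same-chord c∈ (root∈ 1≤L) (inj₁ (sym c₁≡1)) (inj₁ refl)

  ↭-root∷nonRoot : 1 ≤ L → C ↭ (1 , rootEnd C) ∷ nonRoot C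
  ↭-root∷nonRoot 1≤L = unique-set⇒↭ unique
    (tabulate (λ c∈ c≡ → proj₂ (∈-nonRoot⁻ C c∈) (cong proj₁ (sym c≡))) ∷ nonRoot-unique unique)
    to from
    where
    to : ∀ {x} → x ∈ C → x ∈ (1 , rootEnd C) ∷ nonRoot C
    to {x} x∈ with proj₁ x ≟ 1
    ... | yes x₁≡1 = here (root-unique 1≤L x∈ x₁≡1)
    ... | no x₁≢1  = there (∈-nonRoot⁺ C x∈ x₁≢1)
    from : ∀ {x} → x ∈ (1 , rootEnd C) ∷ nonRoot C → x ∈ C
    from (here refl) = root∈ 1≤L
    from (there x∈)  = proj₁ (∈-nonRoot⁻ C x∈)

Cross-sym : ∀ {c d} → Cross c d → Cross d c
Cross-sym (inj₁ x) = inj₂ x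
Cross-sym (inj₂ x) = inj₁ x

Cross-map : ∀ (f : ℕ → ℕ) (Q : ℕ → Set) → (∀ {p q} → Q p → Q q → p < q → f p < f q) →
  ∀ {a b a' b'} → Q a → Q b → Q a' → Q b' → Cross (a , b) (a' , b') → Cross (f a , f b) (f a' , f b')
Cross-map f Q mono qa qb qa' qb' (inj₁ (x , y , z)) = inj₁ (mono qa qa' x , mono qa' qb y , mono qb qb' z)
Cross-map f Q mono qa qb qa' qb' (inj₂ (x , y , z)) = inj₂ (mono qa' qa x , mono qa qb' y , mono qb' qb z)

Cross-map-endpoints : ∀ {D : List Chord} (f : ℕ → ℕ) →
  (∀ {p q} → p ∈ endpoints D → q ∈ endpoints D → p < q → f p < f q) →
  ∀ {x y} → x ∈ D → y ∈ D → Cross x y → Cross (mapChord f x) (mapChord f y)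
Cross-map-endpoints {D} f mono x∈ y∈ = Cross-map f (_∈ endpoints D) mono
  (∈-endpoints⁺ x∈ (inj₁ refl)) (∈-endpoints⁺ x∈ (inj₂ refl))
  (∈-endpoints⁺ y∈ (inj₁ refl)) (∈-endpoints⁺ y∈ (inj₂ refl))

Cross? : ∀ c d → Dec (Cross c d)
Cross? (a , b) (a' , b') =
  (a <? a' ×-dec a' <? b ×-dec b <? b') ⊎-dec (a' <? a ×-dec a <? b' ×-dec b' <? b)

path-++ : ∀ {C a b c} → Path C a b → Path C b c → Path C a c
path-++ here           q = q
path-++ (step d∈ x p) q = step d∈ x (path-++ p q)

path-reverse : ∀ {C a b} → a ∈ C → Path C a b → Path C b a
path-reverse a∈ here           = here
path-reverse a∈ (step d∈ x p) = path-++ (path-reverse d∈ p) (step a∈ (Cross-sym x) here)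

path-mono : ∀ {C D a b} → (∀ {x} → x ∈ C → x ∈ D) → Path C a b → Path D a b
path-mono C⊆D here           = here
path-mono C⊆D (step d∈ x p) = step (C⊆D d∈) x (path-mono C⊆D p)

path-map : ∀ {C D} (f : Chord → Chord) → (∀ {x} → x ∈ C → f x ∈ D) →
  (∀ {x y} → x ∈ C → y ∈ C → Cross x y → Cross (f x) (f y)) →
  ∀ {a b} → a ∈ C → Path C a b → Path D (f a) (f b)
path-map f f∈ f-cross a∈ here           = here
path-map f f∈ f-cross a∈ (step d∈ x p) = step (f∈ d∈) (f-cross a∈ d∈ x) (path-map f f∈ f-cross d∈ p)

connected-via : ∀ {C r} → r ∈ C → (∀ {c} → c ∈ C → Path C c r) → Connected C
connected-via r∈ to-r c∈ d∈ = path-++ (to-r c∈) (path-reverse d∈ (to-r d∈))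

-- Trees and the shifts used by θ

mutual
  suc-places : ∀ t → suc (places t) ≡ 2 * size t
  suc-places (node cs) = trans (cong suc (placesL≡ cs)) (lemma (sizeL cs))
    where
    lemma : ∀ x → suc (suc (2 * x)) ≡ 2 * suc x
    lemma = solve-∀

  placesL≡ : ∀ cs → placesL cs ≡ suc (2 * sizeL cs)
  placesL≡ []       = refl
  placesL≡ (c ∷ cs) = cong suc (begin
    places c + placesL cs             ≡⟨ cong (places c +_) (placesL≡ cs) ⟩
    places c + suc (2 * sizeL cs)     ≡⟨ +-suc (places c) _ ⟩
    suc (places c) + 2 * sizeL cs     ≡⟨ cong (_+ 2 * sizeL cs) (suc-places c) ⟩
    2 * size c + 2 * sizeL cs         ≡⟨ *-distribˡ-+ 2 (size c) (sizeL cs) ⟨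
    2 * (size c + sizeL cs)           ∎)
    where open ≡-Reasoning

mutual
  size-insert : ∀ t j s → size (insert t j s) ≡ size t + size s
  size-insert (node cs) j s = cong suc (sizeL-insertL cs j s)

  sizeL-insertL : ∀ cs j s → sizeL (insertL cs j s) ≡ sizeL cs + size s
  sizeL-insertL []       j       s = +-identityʳ (size s)
  sizeL-insertL (c ∷ cs) zero    s = +-comm (size s) (size c + sizeL cs)
  sizeL-insertL (c ∷ cs) (suc j) s with j <ᵇ places c
  ... | true  = trans (cong (_+ sizeL cs) (size-insert c j s)) (lemma (size c) (size s) (sizeL cs))
    where
    lemma : ∀ a b c → (a + b) + c ≡ (a + c) + b
    lemma = solve-∀
  ... | false = trans (cong (size c +_) (sizeL-insertL cs (j ∸ places c) s))
                      (sym (+-assoc (size c) (sizeL cs) (size s)))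

size≥1 : ∀ t → 1 ≤ size t
size≥1 (node cs) = s≤s z≤n

1≤2*size : ∀ t → 1 ≤ 2 * size t
1≤2*size t = ≤-trans (size≥1 t) (m≤m+n (size t) (size t + 0))

module _ {A : Set} {a b : A} where

  if-≤ᵇ-≤ : ∀ {p i} → p ≤ i → (if p ≤ᵇ i then a else b) ≡ a
  if-≤ᵇ-≤ {p} {i} p≤i with p ≤ᵇ i | ≤⇒≤ᵇ p≤i
  ... | true | _ = refl

  if-≤ᵇ-> : ∀ {p i} → i < p → (if p ≤ᵇ i then a else b) ≡ b
  if-≤ᵇ-> {p} {i} i<p with p ≤ᵇ i in p≤ᵇi
  ... | true  = ⊥-elim (<⇒≱ i<p (≤ᵇ⇒≤ p i (subst T (sym p≤ᵇi) tt)))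
  ... | false = refl

-- The relabelling sh of θ τ'' in the definition of θ, with i the insertion place and m the size of θ τ'.
outerShift : ℕ → ℕ → ℕ → ℕ
outerShift i m p = if p ≤ᵇ i then suc p else p + 2 * m

module _ {i m : ℕ} where

  outerShift-≤ : ∀ {p} → p ≤ i → outerShift i m p ≡ suc p
  outerShift-≤ = if-≤ᵇ-≤

  outerShift-> : ∀ {p} → i < p → outerShift i m p ≡ p + 2 * m
  outerShift-> = if-≤ᵇ->

  outerShift-< : 1 ≤ m → ∀ {p q} → p < q → outerShift i m p < outerShift i m q
  outerShift-< 1≤m {p} {q} p<q with p ≤? i | q ≤? i
  ... | yes p≤i | yes q≤i rewrite outerShift-≤ p≤i | outerShift-≤ q≤i = s<s p<q
  ... | yes p≤i | no q≰i  rewrite outerShift-≤ p≤i | outerShift-> (≰⇒> q≰i) =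
    ≤-trans (s<s p<q) (subst (_≤ q + 2 * m) (+-comm q 1) (+-monoʳ-≤ q (≤-trans 1≤m (m≤m+n m (m + 0)))))
  ... | no p≰i  | yes q≤i = ⊥-elim (p≰i (≤-trans (<⇒≤ p<q) q≤i))
  ... | no p≰i  | no q≰i  rewrite outerShift-> (≰⇒> p≰i) | outerShift-> (≰⇒> q≰i) = +-monoˡ-< (2 * m) p<q

  outerShift-injective : 1 ≤ m → ∀ {p q} → outerShift i m p ≡ outerShift i m q → p ≡ q
  outerShift-injective 1≤m {p} {q} eq with <-cmp p q
  ... | tri< p<q _ _ = ⊥-elim (<⇒≢ (outerShift-< 1≤m p<q) eq)
  ... | tri≈ _ p≡q _ = p≡q
  ... | tri> _ _ q<p = ⊥-elim (<⇒≢ (outerShift-< 1≤m q<p) (sym eq))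

-- θ relabels the root chord (1 , k) of θ τ' as (1 , k + i) and every other point p as p + i;
-- doing both with one map lets crossing paths of θ τ' be transported.
innerShift : ℕ → ℕ → ℕ
innerShift i p = if p ≡ᵇ 1 then 1 else p + i

innerShift-≢1 : ∀ {i p} → p ≢ 1 → innerShift i p ≡ p + i
innerShift-≢1 p≢1 rewrite ≢1⇒≡ᵇ1-false p≢1 = refl

innerShift-< : ∀ {i p q} → 1 ≤ p → p < q → innerShift i p < innerShift i q
innerShift-< {i} {p} {q} 1≤p p<q with p ≟ 1
... | yes refl rewrite innerShift-≢1 {i} {q} (>⇒≢ p<q) = ≤-trans p<q (m≤m+n q i)
... | no p≢1   rewrite innerShift-≢1 {i} p≢1 | innerShift-≢1 {i} {q} (>⇒≢ (≤-<-trans 1≤p p<q)) =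
  +-monoˡ-< i p<q

-- θ produces rooted connected chord diagrams

ConnectedDiagramOn : ℕ → List Chord → Set
ConnectedDiagramOn L C = DiagramOn L C × Connected C

module Join {t' t'' : PTree} (τ' : Tubing t') (τ'' : Tubing t'') (j : Fin (places t''))
  (G' : ConnectedDiagramOn (2 * size t') (θ τ')) (G'' : ConnectedDiagramOn (2 * size t'') (θ τ''))
  where

  module D′  = Diagram (proj₁ G')
  module D″ = Diagram (proj₁ G'')

  C' C'' : List Chord
  C'  = θ τ'
  C'' = θ τ''

  m k k'' i : ℕ
  m   = length C'
  k   = rootEnd C'
  k'' = rootEnd C''
  i   = suc (toℕ j)

  sh : ℕ → ℕ
  sh = outerShift i m

  sh-≤ : ∀ {p} → p ≤ i → sh p ≡ suc p
  sh-≤ = outerShift-≤ {i} {m}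

  sh-> : ∀ {p} → i < p → sh p ≡ p + 2 * m
  sh-> = outerShift-> {i} {m}

  NR : List Chord
  NR = nonRoot C'

  r : Chord
  r = 1 , k + i

  out : List Chord
  out = θ (join τ' τ'' j)

  m≡size : m ≡ size t'
  m≡size = *-cancelˡ-≡ m (size t') 2 D′.2*length

  1≤m : 1 ≤ m
  1≤m = subst (1 ≤_) (sym m≡size) (size≥1 t')

  sh-cross : ∀ {x y} → Cross x y → Cross (mapChord sh x) (mapChord sh y)
  sh-cross = Cross-map sh (λ _ → ⊤) (λ _ _ → outerShift-< 1≤m) tt tt tt tt

  i<2*size'' : i < 2 * size t''
  i<2*size'' = subst (suc i ≤_) (suc-places t'') (s<s (toℕ<n j))

  root∈C' : (1 , k) ∈ C'
  root∈C' = D′.root∈ (1≤2*size t')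

  root∈C'' : (1 , k'') ∈ C''
  root∈C'' = D″.root∈ (1≤2*size t'')

  1<k : 1 < k
  1<k = D′.start<end root∈C'

  k≤2m : k ≤ 2 * m
  k≤2m = subst (λ s → k ≤ 2 * s) (sym m≡size) (D′.end≤ root∈C')

  nonRoot-bounds : ∀ {c} → c ∈ NR → 2 ≤ proj₁ c × proj₁ c < proj₂ c × proj₂ c ≤ 2 * m
  nonRoot-bounds {c} c∈ with ∈-nonRoot⁻ C' c∈
  ... | c∈C' , c₁≢1 = ≤∧≢⇒< (D′.start≥1 c∈C') (c₁≢1 ∘ sym) , D′.start<end c∈C' ,
                      subst (λ s → proj₂ c ≤ 2 * s) (sym m≡size) (D′.end≤ c∈C')

  root∈out : r ∈ out
  root∈out = here refl

  inner∈out : ∀ {c} → c ∈ NR → mapChord (_+ i) c ∈ out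
  inner∈out c∈ = there (∈-++⁺ˡ (∈-map⁺ (mapChord (_+ i)) c∈))

  outer∈out : ∀ {c} → c ∈ C'' → mapChord sh c ∈ out
  outer∈out c∈ = there (∈-++⁺ʳ (map (mapChord (_+ i)) NR) (∈-map⁺ (mapChord sh) c∈))

  ∈-out⁻ : ∀ {x} → x ∈ out → x ≡ r ⊎ (∃ λ c → c ∈ NR × x ≡ mapChord (_+ i) c)
                                   ⊎ (∃ λ c → c ∈ C'' × x ≡ mapChord sh c)
  ∈-out⁻ (here x≡r) = inj₁ x≡r
  ∈-out⁻ (there x∈) with ∈-++⁻ (map (mapChord (_+ i)) NR) x∈
  ... | inj₁ x∈inner = inj₂ (inj₁ (∈-map⁻ (mapChord (_+ i)) x∈inner))
  ... | inj₂ x∈outer = inj₂ (inj₂ (∈-map⁻ (mapChord sh) x∈outer))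

  private
    M N : ℕ
    M = places t'
    N = 2 * size t'' ∸ i

    2*size'≡ : 2 * size t' ≡ suc M
    2*size'≡ = sym (suc-places t')

    2*size''≡ : 2 * size t'' ≡ i + N
    2*size''≡ = sym (m+[n∸m]≡n (<⇒≤ i<2*size''))

    inner-endpoints : (k + i) ∷ map (_+ i) (endpoints NR) ↭ range (2 + i) M
    inner-endpoints = ↭-trans (↭-map⁺ (_+ i) (drop-∷ unshifted))
      (↭-reflexive (map-range (_+ i) 2 M (2 + i) (λ x _ → lemma x i)))
      where
      unshifted : 1 ∷ k ∷ endpoints NR ↭ 1 ∷ range 2 M
      unshifted = ↭-trans (↭-sym (endpoints-↭ (D′.↭-root∷nonRoot (1≤2*size t'))))
                          (subst (λ L → endpoints C' ↭ range 1 L) 2*size'≡ (proj₂ (proj₁ G')))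
      lemma : ∀ x i → 2 + x + i ≡ 2 + i + x
      lemma = solve-∀

    outer-endpoints : map sh (endpoints C'') ↭ range 2 i ++ range (1 + i + 2 * m) N
    outer-endpoints = ↭-trans
      (↭-map⁺ sh (subst (λ L → endpoints C'' ↭ range 1 L) 2*size''≡ (proj₂ (proj₁ G''))))
      (↭-reflexive (begin
        map sh (range 1 (i + N))                       ≡⟨ cong (map sh) (range-++ 1 i N) ⟩
        map sh (range 1 i ++ range (1 + i) N)          ≡⟨ map-++ sh (range 1 i) _ ⟩
        map sh (range 1 i) ++ map sh (range (1 + i) N) ≡⟨ cong₂ _++_ low high ⟩
        range 2 i ++ range (1 + i + 2 * m) N           ∎))
      where
      open ≡-Reasoning
      lemma : ∀ i x m → 1 + i + x + 2 * m ≡ 1 + i + 2 * m + x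
      lemma = solve-∀
      low : map sh (range 1 i) ≡ range 2 i
      low = map-range sh 1 i 2 (λ x x<i → sh-≤ x<i)
      high : map sh (range (1 + i) N) ≡ range (1 + i + 2 * m) N
      high = map-range sh (1 + i) N (1 + i + 2 * m)
        (λ x _ → trans (sh-> {1 + i + x} (s≤s (m≤m+n i x))) (lemma i x m))

    range-out : range 1 (2 * size (insert t'' (toℕ j) t'))
                ≡ 1 ∷ (range 2 i ++ (range (2 + i) M ++ range (1 + i + 2 * m) N))
    range-out = begin
      range 1 (2 * size (insert t'' (toℕ j) t'))
        ≡⟨ cong (range 1) 2*size-out ⟩
      1 ∷ range 2 (i + (M + N))
        ≡⟨ cong (1 ∷_) (range-++ 2 i (M + N)) ⟩
      1 ∷ (range 2 i ++ range (2 + i) (M + N))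
        ≡⟨ cong (λ l → 1 ∷ (range 2 i ++ l)) (range-++ (2 + i) M N) ⟩
      1 ∷ (range 2 i ++ (range (2 + i) M ++ range (2 + i + M) N))
        ≡⟨ cong (λ a → 1 ∷ (range 2 i ++ (range (2 + i) M ++ range a N))) gap-end ⟩
      1 ∷ (range 2 i ++ (range (2 + i) M ++ range (1 + i + 2 * m) N)) ∎
      where
      open ≡-Reasoning
      2*size-out : 2 * size (insert t'' (toℕ j) t') ≡ suc (i + (M + N))
      2*size-out = trans (cong (2 *_) (size-insert t'' (toℕ j) t'))
        (trans (*-distribˡ-+ 2 (size t'') (size t')) (trans (cong₂ _+_ 2*size''≡ 2*size'≡) (lemma i N M)))
        where
        lemma : ∀ i N M → (i + N) + suc M ≡ suc (i + (M + N))
        lemma = solve-∀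
      gap-end : 2 + i + M ≡ 1 + i + 2 * m
      gap-end = trans (lemma i M) (cong (λ z → 1 + i + z) (sym (trans (cong (2 *_) m≡size) 2*size'≡)))
        where
        lemma : ∀ i M → 2 + i + M ≡ 1 + i + suc M
        lemma = solve-∀

  endpoints-out : endpoints out ↭ range 1 (2 * size (insert t'' (toℕ j) t'))
  endpoints-out = ↭-trans (↭-reflexive endpoints≡)
    (↭-trans (↭prep 1 (↭-trans (++⁺ inner-endpoints outer-endpoints) (shifts (range (2 + i) M) (range 2 i))))
             (↭-reflexive (sym range-out)))
    where
    endpoints≡ : endpoints out ≡ 1 ∷ (k + i) ∷ (map (_+ i) (endpoints NR) ++ map sh (endpoints C''))
    endpoints≡ = cong (λ z → 1 ∷ (k + i) ∷ z)
      (trans (endpoints-++ (map (mapChord (_+ i)) NR) (map (mapChord sh) C''))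
             (cong₂ _++_ (endpoints-map (_+ i) NR) (endpoints-map sh C'')))

  out-ordered : All (λ c → proj₁ c < proj₂ c) out
  out-ordered = tabulate ordered
    where
    ordered : ∀ {x} → x ∈ out → proj₁ x < proj₂ x
    ordered x∈ with ∈-out⁻ x∈
    ... | inj₁ refl                   = <-≤-trans 1<k (m≤m+n k i)
    ... | inj₂ (inj₁ (c , c∈ , refl)) = +-monoˡ-< i (proj₁ (proj₂ (nonRoot-bounds c∈)))
    ... | inj₂ (inj₂ (c , c∈ , refl)) = outerShift-< 1≤m (D″.start<end c∈)

  out-diagram : DiagramOn (2 * size (insert t'' (toℕ j) t')) out
  out-diagram = out-ordered , endpoints-out

  innerShift-root : mapChord (innerShift i) (1 , k) ≡ r
  innerShift-root = cong (1 ,_) (innerShift-≢1 (>⇒≢ 1<k))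

  innerShift-nonRoot : ∀ {c} → c ∈ C' → proj₁ c ≢ 1 → mapChord (innerShift i) c ≡ mapChord (_+ i) c
  innerShift-nonRoot c∈ c₁≢1 =
    cong₂ _,_ (innerShift-≢1 c₁≢1) (innerShift-≢1 (>⇒≢ (≤-<-trans (D′.start≥1 c∈) (D′.start<end c∈))))

  innerShift∈out : ∀ {c} → c ∈ C' → mapChord (innerShift i) c ∈ out
  innerShift∈out {c} c∈ with proj₁ c ≟ 1
  ... | yes c₁≡1 = subst (_∈ out) (sym (trans (cong (mapChord (innerShift i)) root) innerShift-root)) root∈out
    where
    root : c ≡ (1 , k)
    root = D′.root-unique (1≤2*size t') c∈ c₁≡1
  ... | no c₁≢1  = subst (_∈ out) (sym (innerShift-nonRoot c∈ c₁≢1)) (inner∈out (∈-nonRoot⁺ C' c∈ c₁≢1))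

  inner-path-to-root : ∀ {c} → c ∈ C' → Path out (mapChord (innerShift i) c) r
  inner-path-to-root c∈ = subst (Path out _) innerShift-root
    (path-map (mapChord (innerShift i)) innerShift∈out cross c∈ (proj₂ G' c∈ root∈C'))
    where
    end≥1 : ∀ {c} → c ∈ C' → 1 ≤ proj₂ c
    end≥1 c∈ = ≤-trans (D′.start≥1 c∈) (<⇒≤ (D′.start<end c∈))
    cross : ∀ {x y} → x ∈ C' → y ∈ C' → Cross x y →
            Cross (mapChord (innerShift i) x) (mapChord (innerShift i) y)
    cross x∈ y∈ = Cross-map (innerShift i) (1 ≤_) (λ 1≤p _ → innerShift-< 1≤p)
      (D′.start≥1 x∈) (end≥1 x∈) (D′.start≥1 y∈) (end≥1 y∈)

  -- The path in C'' from its root chord to the chord at point 2 * size t'' has to jump over i.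
  straddling : ∃ λ s → s ∈ C'' × proj₁ s ≤ i × i < proj₂ s
  straddling with D″.chord-at (1≤2*size t'') ≤-refl
  ... | e , e∈ , last∈e = go root∈C'' (s≤s z≤n) (proj₂ G'' root∈C'' e∈) (ends-after-i last∈e)
    where
    ends-after-i : 2 * size t'' ∈ᶜ e → i < proj₂ e
    ends-after-i (inj₁ x) = <-trans i<2*size'' (subst (_< proj₂ e) (sym x) (D″.start<end e∈))
    ends-after-i (inj₂ x) = subst (i <_) x i<2*size''
    go : ∀ {a b} → a ∈ C'' → proj₁ a ≤ i → Path C'' a b → i < proj₂ b →
         ∃ λ s → s ∈ C'' × proj₁ s ≤ i × i < proj₂ s
    go a∈ a₁≤i here           i<b₂ = _ , a∈ , a₁≤i , i<b₂
    go {a} a∈ a₁≤i (step {d = d} d∈ x p) i<b₂ with i <? proj₂ a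
    ... | yes i<a₂ = a , a∈ , a₁≤i , i<a₂
    ... | no i≮a₂  = go d∈ (d₁≤i x) p i<b₂
      where
      d₁≤i : Cross a d → proj₁ d ≤ i
      d₁≤i (inj₁ (_ , y , _)) = ≤-trans (<⇒≤ y) (≮⇒≥ i≮a₂)
      d₁≤i (inj₂ (y , _))     = ≤-trans (<⇒≤ y) a₁≤i

  outer-crosses-root : ∃ λ s → s ∈ C'' × Cross (mapChord sh s) r
  outer-crosses-root with straddling
  ... | s , s∈ , s₁≤i , i<s₂ = s , s∈ , inj₂ (1<sh-s₁ , sh-s₁<k+i , k+i<sh-s₂)
    where
    sh-s₁ : sh (proj₁ s) ≡ suc (proj₁ s)
    sh-s₁ = sh-≤ s₁≤i
    1<sh-s₁ : 1 < sh (proj₁ s)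
    1<sh-s₁ = subst (1 <_) (sym sh-s₁) (s≤s (D″.start≥1 s∈))
    sh-s₁<k+i : sh (proj₁ s) < k + i
    sh-s₁<k+i = subst (_< k + i) (sym sh-s₁) (≤-trans (s≤s (s≤s s₁≤i)) (+-monoˡ-≤ i 1<k))
    k+i<sh-s₂ : k + i < sh (proj₂ s)
    k+i<sh-s₂ = subst (k + i <_) (sym (sh-> i<s₂))
      (subst (k + i <_) (+-comm (2 * m) (proj₂ s)) (+-mono-≤-< k≤2m i<s₂))

  outer-path-to-root : ∀ {c} → c ∈ C'' → Path out (mapChord sh c) r
  outer-path-to-root c∈ with outer-crosses-root
  ... | s , s∈ , crosses = path-++
    (path-map (mapChord sh) outer∈out (λ _ _ → sh-cross) c∈ (proj₂ G'' c∈ s∈))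
    (step root∈out crosses here)

  path-to-root : ∀ {x} → x ∈ out → Path out x r
  path-to-root x∈ with ∈-out⁻ x∈
  ... | inj₁ refl = here
  ... | inj₂ (inj₁ (c , c∈ , refl)) with ∈-nonRoot⁻ C' c∈
  ...   | c∈C' , c₁≢1 = subst (λ z → Path out z r) (innerShift-nonRoot c∈C' c₁≢1) (inner-path-to-root c∈C')
  path-to-root x∈ | inj₂ (inj₂ (c , c∈ , refl)) = outer-path-to-root c∈

  out-connectedDiagram : ConnectedDiagramOn (2 * size (insert t'' (toℕ j) t')) out
  out-connectedDiagram = out-diagram , connected-via root∈out path-to-root

  OuterPoint : ℕ → Set
  OuterPoint q = q ≤ suc i ⊎ i + 2 * m < q

  InnerPoint : ℕ → Set
  InnerPoint q = suc i < q × q ≤ i + 2 * m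

  ¬inner×outer : ∀ {q} → InnerPoint q → OuterPoint q → ⊥
  ¬inner×outer (i+1<q , _) (inj₁ q≤i+1)   = <⇒≱ i+1<q q≤i+1
  ¬inner×outer (_ , q≤i+2m) (inj₂ i+2m<q) = <⇒≱ i+2m<q q≤i+2m

  sh-outer : ∀ p → OuterPoint (sh p)
  sh-outer p with p ≤? i
  ... | yes p≤i = inj₁ (subst (_≤ suc i) (sym (sh-≤ p≤i)) (s≤s p≤i))
  ... | no p≰i  = inj₂ (subst (i + 2 * m <_) (sym (sh-> (≰⇒> p≰i))) (+-monoˡ-< (2 * m) (≰⇒> p≰i)))

  inner-inner : ∀ {c} → c ∈ NR → InnerPoint (proj₁ c + i) × InnerPoint (proj₂ c + i)
  inner-inner {c} c∈ with nonRoot-bounds c∈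
  ... | 2≤c₁ , c₁<c₂ , c₂≤2m = (+-monoˡ-≤ i 2≤c₁ , shifted≤ (≤-trans (<⇒≤ c₁<c₂) c₂≤2m)) ,
                               (+-monoˡ-≤ i (≤-trans 2≤c₁ (<⇒≤ c₁<c₂)) , shifted≤ c₂≤2m)
    where
    shifted≤ : ∀ {x} → x ≤ 2 * m → x + i ≤ i + 2 * m
    shifted≤ {x} x≤2m = subst (x + i ≤_) (+-comm (2 * m) i) (+-monoˡ-≤ i x≤2m)

  outer-inner-¬Cross : ∀ {x y} → OuterPoint (proj₁ x) → OuterPoint (proj₂ x) →
                       InnerPoint (proj₁ y) → InnerPoint (proj₂ y) → ¬ Cross x y
  outer-inner-¬Cross _ x₂ (l₁ , _) (_ , u₂) (inj₁ (_ , b , c)) =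
    ¬inner×outer (<-trans l₁ b , ≤-trans (<⇒≤ c) u₂) x₂
  outer-inner-¬Cross x₁ _ (l₁ , _) (_ , u₂) (inj₂ (a , b , _)) =
    ¬inner×outer (<-trans l₁ a , ≤-trans (<⇒≤ b) u₂) x₁

  OuterEndpoint : ℕ → Set
  OuterEndpoint q = ∃ λ c → c ∈ C'' × q ∈ᶜ mapChord sh c

  low-outerEndpoint : ∀ {q} → 2 ≤ q → q ≤ suc i → OuterEndpoint q
  low-outerEndpoint {suc p} (s≤s 1≤p) p+1≤i+1
    with D″.chord-at {p} 1≤p (≤-trans (≤-pred p+1≤i+1) (<⇒≤ i<2*size''))
  ... | c , c∈ , p∈c = c , c∈ , Sum.map shifted shifted p∈c
    where
    shifted : ∀ {a} → p ≡ a → suc p ≡ sh a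
    shifted refl = sym (sh-≤ (≤-pred p+1≤i+1))

  high-outerEndpoint : ∀ {q} → i + 2 * m < q → q ≤ 2 * size t'' + 2 * m → OuterEndpoint q
  high-outerEndpoint {q} i+2m<q q≤ = lift (D″.chord-at (≤-trans (s≤s z≤n) i<q∸2m) q∸2m≤)
    where
    i<q∸2m : i < q ∸ 2 * m
    i<q∸2m = subst (_< q ∸ 2 * m) (m+n∸n≡m i (2 * m)) (∸-monoˡ-< i+2m<q (m≤n+m (2 * m) i))
    q∸2m≤ : q ∸ 2 * m ≤ 2 * size t''
    q∸2m≤ = subst (q ∸ 2 * m ≤_) (m+n∸n≡m (2 * size t'') (2 * m)) (∸-monoˡ-≤ (2 * m) q≤)
    shifted : ∀ {a} → q ∸ 2 * m ≡ a → q ≡ sh a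
    shifted refl = sym (trans (sh-> i<q∸2m) (m∸n+n≡m (≤-trans (m≤n+m (2 * m) i) (<⇒≤ i+2m<q))))
    lift : (∃ λ c → c ∈ C'' × q ∸ 2 * m ∈ᶜ c) → OuterEndpoint q
    lift (c , c∈ , q∸2m∈c) = c , c∈ , Sum.map shifted shifted q∸2m∈c

  ¬inner-outerEndpoint : ∀ {q} → InnerPoint q → ¬ OuterEndpoint q
  ¬inner-outerEndpoint q-inner (c , _ , inj₁ refl) = ¬inner×outer q-inner (sh-outer (proj₁ c))
  ¬inner-outerEndpoint q-inner (c , _ , inj₂ refl) = ¬inner×outer q-inner (sh-outer (proj₂ c))

  2≤sh : ∀ {p} → 1 ≤ p → 2 ≤ sh p
  2≤sh {p} 1≤p with p ≤? i
  ... | yes p≤i = subst (2 ≤_) (sym (sh-≤ p≤i)) (s≤s 1≤p)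
  ... | no p≰i  = subst (2 ≤_) (sym (sh-> (≰⇒> p≰i)))
                    (≤-trans (≤-trans (s≤s (s≤s z≤n)) (≰⇒> p≰i)) (m≤m+n p (2 * m)))

  outerRoot : Chord
  outerRoot = mapChord sh (1 , k'')

  outerRoot-starts-at-2 : proj₁ outerRoot ≡ 2
  outerRoot-starts-at-2 = sh-≤ (s≤s z≤n)

  outer : List Chord
  outer = map (mapChord sh) C''

  outer⊆out : ∀ {x} → x ∈ outer → x ∈ out
  outer⊆out = there ∘ ∈-++⁺ʳ (map (mapChord (_+ i)) NR)

  outer-path : ∀ {c} → c ∈ C'' → Path outer outerRoot (mapChord sh c)
  outer-path c∈ = path-map (mapChord sh) (∈-map⁺ (mapChord sh))
    (λ _ _ → sh-cross) root∈C'' (proj₂ G'' root∈C'' c∈)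

  ∈-out⁻-nonRoot : ∀ {x} → x ∈ out → proj₁ x ≢ 1 →
    (∃ λ c → c ∈ NR × x ≡ mapChord (_+ i) c) ⊎ (∃ λ c → c ∈ C'' × x ≡ mapChord sh c)
  ∈-out⁻-nonRoot x∈ x₁≢1 with ∈-out⁻ x∈
  ... | inj₁ refl = ⊥-elim (x₁≢1 refl)
  ... | inj₂ y    = y

  2<inner-start : ∀ {c} → c ∈ NR → 2 < proj₁ c + i
  2<inner-start c∈ = ≤-trans (s≤s (s≤s (s≤s z≤n))) (proj₁ (proj₁ (inner-inner c∈)))

θ-connectedDiagram : ∀ {t} (τ : Tubing t) → ConnectedDiagramOn (2 * size t) (θ τ)
θ-connectedDiagram single           = (s<s z<s ∷ [] , ↭refl) , λ { (here refl) (here refl) → here }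
θ-connectedDiagram (join τ' τ'' j) =
  Join.out-connectedDiagram τ' τ'' j (θ-connectedDiagram τ') (θ-connectedDiagram τ'')

-- Injectivity

module JoinOf {t' t'' : PTree} (τ' : Tubing t') (τ'' : Tubing t'') (j : Fin (places t'')) =
  Join τ' τ'' j (θ-connectedDiagram τ') (θ-connectedDiagram τ'')

module Compare {t₁' t₁'' t₂' t₂'' : PTree}
  (τ₁' : Tubing t₁') (τ₁'' : Tubing t₁'') (j₁ : Fin (places t₁''))
  (τ₂' : Tubing t₂') (τ₂'' : Tubing t₂'') (j₂ : Fin (places t₂''))
  (out₁⊆out₂ : ∀ {x} → x ∈ θ (join τ₁' τ₁'' j₁) → x ∈ θ (join τ₂' τ₂'' j₂)) where

  module J₁ = JoinOf τ₁' τ₁'' j₁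
  module J₂ = JoinOf τ₂' τ₂'' j₂

  ≥2⇒≢1 : ∀ {n} → 2 ≤ n → n ≢ 1
  ≥2⇒≢1 2≤n n≡1 = <-irrefl (sym n≡1) 2≤n

  -- Outer chords of the second diagram only touch outer points and inner ones only inner points,
  -- so a crossing path starting among the outer chords stays there.
  outer-stays-outer : ∀ {x y} → (∃ λ d → d ∈ J₂.C'' × x ≡ mapChord J₂.sh d) → Path J₁.outer x y →
                      ∃ λ d → d ∈ J₂.C'' × y ≡ mapChord J₂.sh d
  outer-stays-outer x-outer here = x-outer
  outer-stays-outer (d , d∈ , refl) (step y∈ crosses p) with ∈-map⁻ (mapChord J₁.sh) y∈
  ... | c , c∈ , refl
    with J₂.∈-out⁻-nonRoot (out₁⊆out₂ (J₁.outer⊆out y∈)) (≥2⇒≢1 (J₁.2≤sh (J₁.D″.start≥1 c∈)))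
  ...   | inj₂ y-outer = outer-stays-outer y-outer p
  ...   | inj₁ (e , e∈ , y≡) = ⊥-elim (J₂.outer-inner-¬Cross (J₂.sh-outer (proj₁ d)) (J₂.sh-outer (proj₂ d))
          (subst J₂.InnerPoint (cong proj₁ (sym y≡)) (proj₁ (J₂.inner-inner e∈)))
          (subst J₂.InnerPoint (cong proj₂ (sym y≡)) (proj₂ (J₂.inner-inner e∈))) crosses)

  outerRoot-outer : ∃ λ d → d ∈ J₂.C'' × J₁.outerRoot ≡ mapChord J₂.sh d
  outerRoot-outer with J₂.∈-out⁻-nonRoot (out₁⊆out₂ (J₁.outer⊆out (∈-map⁺ (mapChord J₁.sh) J₁.root∈C'')))
                                        (≥2⇒≢1 (J₁.2≤sh (J₁.D″.start≥1 J₁.root∈C'')))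
  ... | inj₂ outer = outer
  ... | inj₁ (e , e∈ , eq) =
    ⊥-elim (<-irrefl (trans (sym J₁.outerRoot-starts-at-2) (cong proj₁ eq)) (J₂.2<inner-start e∈))

  outer⊆outer : ∀ {c} → c ∈ J₁.C'' → ∃ λ d → d ∈ J₂.C'' × mapChord J₁.sh c ≡ mapChord J₂.sh d
  outer⊆outer c∈ = outer-stays-outer outerRoot-outer (J₁.outer-path c∈)

  outerEndpoint⊆ : ∀ {q} → J₁.OuterEndpoint q → J₂.OuterEndpoint q
  outerEndpoint⊆ (c , c∈ , q∈) with outer⊆outer c∈
  ... | d , d∈ , eq = d , d∈ , Sum.map (λ { refl → cong proj₁ eq }) (λ { refl → cong proj₂ eq }) q∈

  root-end≡ : J₁.k + J₁.i ≡ J₂.k + J₂.i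
  root-end≡ with J₂.∈-out⁻ (out₁⊆out₂ J₁.root∈out)
  ... | inj₁ eq                      = cong proj₂ eq
  ... | inj₂ (inj₁ (e , e∈ , eq)) =
    ⊥-elim (<-irrefl (cong proj₁ eq) (<-trans (s≤s (s≤s z≤n)) (J₂.2<inner-start e∈)))
  ... | inj₂ (inj₂ (e , e∈ , eq)) = ⊥-elim (<-irrefl (cong proj₁ eq) (J₂.2≤sh (J₂.D″.start≥1 e∈)))

  -- Point i₂ + 2 is inner for the second diagram but would be an outer point of the first.
  ¬i₂<i₁ : ¬ J₂.i < J₁.i
  ¬i₂<i₁ i₂<i₁ = J₂.¬inner-outerEndpoint inner
    (outerEndpoint⊆ (J₁.low-outerEndpoint (s≤s (s≤s z≤n)) (s≤s i₂<i₁)))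
    where
    inner : J₂.InnerPoint (2 + J₂.i)
    inner = ≤-refl , subst (2 + J₂.i ≤_) (+-comm (2 * J₂.m) J₂.i) (+-monoˡ-≤ J₂.i (*-monoʳ-≤ 2 J₂.1≤m))

  -- With equal insertion places, point i + 2 m₁ + 1 is outer for the first diagram and inner for the second.
  ¬m₁<m₂ : J₁.i ≡ J₂.i → ¬ J₁.m < J₂.m
  ¬m₁<m₂ i₁≡i₂ m₁<m₂ = J₂.¬inner-outerEndpoint (inner₁ , inner₂)
    (outerEndpoint⊆ (J₁.high-outerEndpoint (≤-reflexive (+-comm 1 _)) q≤))
    where
    q : ℕ
    q = J₁.i + 2 * J₁.m + 1
    q≤ : q ≤ 2 * size t₁'' + 2 * J₁.m
    q≤ = subst (_≤ 2 * size t₁'' + 2 * J₁.m) (lemma J₁.i (2 * J₁.m)) (+-monoˡ-≤ (2 * J₁.m) J₁.i<2*size'')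
      where
      lemma : ∀ a b → suc a + b ≡ a + b + 1
      lemma = solve-∀
    inner₁ : suc J₂.i < q
    inner₁ = subst (λ z → suc z < q) i₁≡i₂
      (≤-trans (n≤1+n _) (subst (_≤ q) (lemma J₁.i) (+-monoˡ-≤ 1 (+-monoʳ-≤ J₁.i (*-monoʳ-≤ 2 J₁.1≤m)))))
      where
      lemma : ∀ i → i + 2 * 1 + 1 ≡ suc (suc (suc i))
      lemma = solve-∀
    inner₂ : q ≤ J₂.i + 2 * J₂.m
    inner₂ = subst (λ z → q ≤ z + 2 * J₂.m) i₁≡i₂
      (≤-trans (≤-trans (n≤1+n q) (≤-reflexive (lemma J₁.i J₁.m))) (+-monoʳ-≤ J₁.i (*-monoʳ-≤ 2 m₁<m₂)))
      where
      lemma : ∀ i m → suc (i + 2 * m + 1) ≡ i + 2 * suc m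
      lemma = solve-∀

  module _ (i₁≡i₂ : J₁.i ≡ J₂.i) (m₁≡m₂ : J₁.m ≡ J₂.m) where

    C''₁⊆C''₂ : ∀ {c} → c ∈ J₁.C'' → c ∈ J₂.C''
    C''₁⊆C''₂ {c} c∈ with outer⊆outer c∈
    ... | d , d∈ , eq = subst (_∈ J₂.C'') (sym (cong₂ _,_ (unshift (cong proj₁ eq)) (unshift (cong proj₂ eq)))) d∈
      where
      unshift : ∀ {p q} → J₁.sh p ≡ J₂.sh q → p ≡ q
      unshift {p} eq =
        outerShift-injective J₂.1≤m (trans (cong₂ (λ a b → outerShift a b p) (sym i₁≡i₂) (sym m₁≡m₂)) eq)

    NR₁⊆NR₂ : ∀ {c} → c ∈ J₁.NR → c ∈ J₂.NR
    NR₁⊆NR₂ {c} c∈ with J₂.∈-out⁻-nonRoot (out₁⊆out₂ (J₁.inner∈out c∈)) (≥2⇒≢1 (<⇒≤ (J₁.2<inner-start c∈)))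
    ... | inj₂ (e , e∈ , eq) =
      ⊥-elim (J₂.¬inner×outer (subst J₂.InnerPoint (cong proj₁ eq) inner) (J₂.sh-outer (proj₁ e)))
      where
      inner : J₂.InnerPoint (proj₁ c + J₁.i)
      inner with proj₁ (J₁.inner-inner c∈)
      ... | i₁+1< , ≤i₁+2m₁ = subst (λ z → suc z < proj₁ c + J₁.i) i₁≡i₂ i₁+1< ,
                              subst (proj₁ c + J₁.i ≤_) (cong₂ (λ a b → a + 2 * b) i₁≡i₂ m₁≡m₂) ≤i₁+2m₁
    ... | inj₁ (e , e∈ , eq) =
      subst (_∈ J₂.NR) (sym (cong₂ _,_ (unshift (cong proj₁ eq)) (unshift (cong proj₂ eq)))) e∈
      where
      unshift : ∀ {p q} → p + J₁.i ≡ q + J₂.i → p ≡ q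
      unshift {p} {q} eq = +-cancelʳ-≡ J₂.i p q (subst (λ z → p + z ≡ q + J₂.i) i₁≡i₂ eq)

    k₁≡k₂ : J₁.k ≡ J₂.k
    k₁≡k₂ = +-cancelʳ-≡ J₂.i J₁.k J₂.k (subst (λ z → J₁.k + z ≡ J₂.k + J₂.i) i₁≡i₂ root-end≡)

    C'₁⊆C'₂ : ∀ {c} → c ∈ J₁.C' → c ∈ J₂.C'
    C'₁⊆C'₂ {c} c∈ with proj₁ c ≟ 1
    ... | yes c₁≡1 = subst (_∈ J₂.C') (sym (trans root₁ (cong (1 ,_) k₁≡k₂))) J₂.root∈C'
      where
      root₁ : c ≡ (1 , J₁.k)
      root₁ = J₁.D′.root-unique (1≤2*size t₁') c∈ c₁≡1
    ... | no c₁≢1  = proj₁ (∈-nonRoot⁻ J₂.C' (NR₁⊆NR₂ (∈-nonRoot⁺ J₁.C' c∈ c₁≢1)))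

join-≡ : ∀ {t₁' t₁'' t₂' t₂''} {τ₁' : Tubing t₁'} {τ₁'' : Tubing t₁''}
  {τ₂' : Tubing t₂'} {τ₂'' : Tubing t₂''} {j₁ : Fin (places t₁'')} {j₂ : Fin (places t₂'')} →
  _≡_ {A = Σ PTree Tubing} (t₁' , τ₁') (t₂' , τ₂') →
  _≡_ {A = Σ PTree Tubing} (t₁'' , τ₁'') (t₂'' , τ₂'') →
  toℕ j₁ ≡ toℕ j₂ → _≡_ {A = Σ PTree Tubing} (_ , join τ₁' τ₁'' j₁) (_ , join τ₂' τ₂'' j₂)
join-≡ refl refl j₁≡j₂ with toℕ-injective j₁≡j₂
... | refl = refl

join-⊈-single : ∀ {t' t''} (τ' : Tubing t') (τ'' : Tubing t'') (j : Fin (places t'')) →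
  ¬ (∀ {x} → x ∈ θ (join τ' τ'' j) → x ∈ θ single)
join-⊈-single τ' τ'' j ⊆single with ⊆single (J.outer⊆out (∈-map⁺ _ J.root∈C''))
  where module J = JoinOf τ' τ'' j
... | here eq = 1≢2 (trans (cong proj₁ (sym eq)) (JoinOf.outerRoot-starts-at-2 τ' τ'' j))
  where
  1≢2 : 1 ≢ 2
  1≢2 ()

≮∧≯⇒≡ : ∀ {a b} → ¬ a < b → ¬ b < a → a ≡ b
≮∧≯⇒≡ a≮b b≮a = ≤-antisym (≮⇒≥ b≮a) (≮⇒≥ a≮b)

θ-injective : ∀ {t₁ t₂} (τ₁ : Tubing t₁) (τ₂ : Tubing t₂) → θ τ₁ ↭ θ τ₂ →
              _≡_ {A = Σ PTree Tubing} (t₁ , τ₁) (t₂ , τ₂)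
θ-injective single single _ = refl
θ-injective single (join τ' τ'' j) p = ⊥-elim (join-⊈-single τ' τ'' j (∈-resp-↭ (↭-sym p)))
θ-injective (join τ' τ'' j) single p = ⊥-elim (join-⊈-single τ' τ'' j (∈-resp-↭ p))
θ-injective (join τ₁' τ₁'' j₁) (join τ₂' τ₂'' j₂) p =
  join-≡ (θ-injective τ₁' τ₂' C'↭) (θ-injective τ₁'' τ₂'' C''↭) (suc-injective i₁≡i₂)
  where
  module J₁  = JoinOf τ₁' τ₁'' j₁
  module J₂  = JoinOf τ₂' τ₂'' j₂
  module 1⊆2 = Compare τ₁' τ₁'' j₁ τ₂' τ₂'' j₂ (∈-resp-↭ p)
  module 2⊆1 = Compare τ₂' τ₂'' j₂ τ₁' τ₁'' j₁ (∈-resp-↭ (↭-sym p))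
  i₁≡i₂ : J₁.i ≡ J₂.i
  i₁≡i₂ = ≮∧≯⇒≡ 2⊆1.¬i₂<i₁ 1⊆2.¬i₂<i₁
  m₁≡m₂ : J₁.m ≡ J₂.m
  m₁≡m₂ = ≮∧≯⇒≡ (1⊆2.¬m₁<m₂ i₁≡i₂) (2⊆1.¬m₁<m₂ (sym i₁≡i₂))
  C''↭ : J₁.C'' ↭ J₂.C''
  C''↭ = unique-set⇒↭ J₁.D″.unique J₂.D″.unique
    (1⊆2.C''₁⊆C''₂ i₁≡i₂ m₁≡m₂) (2⊆1.C''₁⊆C''₂ (sym i₁≡i₂) (sym m₁≡m₂))
  C'↭ : J₁.C' ↭ J₂.C'
  C'↭ = unique-set⇒↭ J₁.D′.unique J₂.D′.unique
    (1⊆2.C'₁⊆C'₂ i₁≡i₂ m₁≡m₂) (2⊆1.C'₁⊆C'₂ (sym i₁≡i₂) (sym m₁≡m₂))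

-- Surjectivity

record GreatestIn (P : ℕ → Set) (lo hi : ℕ) : Set where
  field
    value      : ℕ
    lo≤value   : lo ≤ value
    value≤hi   : value ≤ hi
    holds      : P value
    none-above : ∀ q → value < q → q ≤ hi → ¬ P q

record LeastIn (P : ℕ → Set) (lo hi : ℕ) : Set where
  field
    value      : ℕ
    lo≤value   : lo ≤ value
    value≤hi   : value ≤ hi
    holds      : P value
    none-below : ∀ q → lo ≤ q → q < value → ¬ P q

opaque
  greatest-in : ∀ (P : ℕ → Set) → (∀ q → Dec (P q)) → ∀ d {lo} → P lo → GreatestIn P lo (lo + d)
  greatest-in P P? zero {lo} Plo = record
    { value = lo ; lo≤value = ≤-refl ; value≤hi = m≤m+n lo 0 ; holds = Plo
    ; none-above = λ q lo<q q≤lo+0 → ⊥-elim (<⇒≱ lo<q (subst (q ≤_) (+-identityʳ lo) q≤lo+0)) }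
  greatest-in P P? (suc d) {lo} Plo with P? (lo + suc d)
  ... | yes Ptop = record
    { value = lo + suc d ; lo≤value = m≤m+n lo (suc d) ; value≤hi = ≤-refl ; holds = Ptop
    ; none-above = λ q top<q q≤top → ⊥-elim (<⇒≱ top<q q≤top) }
  ... | no ¬Ptop = record
    { value = value ; lo≤value = lo≤value ; value≤hi = ≤-trans value≤hi (+-monoʳ-≤ lo (n≤1+n d)) ; holds = holds
    ; none-above = none-above′ }
    where
    open GreatestIn (greatest-in P P? d Plo)
    none-above′ : ∀ q → value < q → q ≤ lo + suc d → ¬ P q
    none-above′ q value<q q≤ with m≤n⇒m<n∨m≡n q≤
    ... | inj₁ q<top = none-above q value<q (≤-pred (subst (q <_) (+-suc lo d) q<top))
    ... | inj₂ refl  = ¬Ptop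

  least-in : ∀ (P : ℕ → Set) → (∀ q → Dec (P q)) → ∀ d {lo} → P (lo + d) → LeastIn P lo (lo + d)
  least-in P P? zero {lo} Ptop = record
    { value = lo ; lo≤value = ≤-refl ; value≤hi = m≤m+n lo 0 ; holds = subst P (+-identityʳ lo) Ptop
    ; none-below = λ q lo≤q q<lo → ⊥-elim (<⇒≱ q<lo lo≤q) }
  least-in P P? (suc d) {lo} Ptop with P? lo
  ... | yes Plo = record
    { value = lo ; lo≤value = ≤-refl ; value≤hi = m≤m+n lo (suc d) ; holds = Plo
    ; none-below = λ q lo≤q q<lo → ⊥-elim (<⇒≱ q<lo lo≤q) }
  ... | no ¬Plo = record
    { value = value ; lo≤value = <⇒≤ lo≤value ; value≤hi = subst (value ≤_) (sym (+-suc lo d)) value≤hi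
    ; holds = holds ; none-below = none-below′ }
    where
    open LeastIn (least-in P P? d {suc lo} (subst P (+-suc lo d) Ptop))
    none-below′ : ∀ q → lo ≤ q → q < value → ¬ P q
    none-below′ q lo≤q q<value with m≤n⇒m<n∨m≡n lo≤q
    ... | inj₁ lo<q = none-below q lo<q q<value
    ... | inj₂ refl = ¬Plo

map-diagramOn : ∀ (D : List Chord) (f : ℕ → ℕ) (N : ℕ) → Unique (endpoints D) →
  All (λ c → proj₁ c < proj₂ c) D →
  (∀ {p q} → p ∈ endpoints D → q ∈ endpoints D → p < q → f p < f q) →
  (∀ {p} → p ∈ endpoints D → 1 ≤ f p × f p ≤ N) →
  (∀ {q} → 1 ≤ q → q ≤ N → ∃ λ p → p ∈ endpoints D × f p ≡ q) →
  DiagramOn N (map (mapChord f) D)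
map-diagramOn D f N unique ordered mono bounded onto =
  tabulate ordered′ , subst (_↭ range 1 N) (sym (endpoints-map f D)) image↭range
  where
  ordered′ : ∀ {x} → x ∈ map (mapChord f) D → proj₁ x < proj₂ x
  ordered′ x∈ with ∈-map⁻ (mapChord f) x∈
  ... | c , c∈ , refl = mono (∈-endpoints⁺ c∈ (inj₁ refl)) (∈-endpoints⁺ c∈ (inj₂ refl)) (All.lookup ordered c∈)
  injective : ∀ {p q} → p ∈ endpoints D → q ∈ endpoints D → f p ≡ f q → p ≡ q
  injective p∈ q∈ fp≡fq with <-cmp _ _
  ... | tri< p<q _ _ = ⊥-elim (<⇒≢ (mono p∈ q∈ p<q) fp≡fq)
  ... | tri≈ _ p≡q _ = p≡q
  ... | tri> _ _ q<p = ⊥-elim (<⇒≢ (mono q∈ p∈ q<p) (sym fp≡fq))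
  image↭range : map f (endpoints D) ↭ range 1 N
  image↭range = unique-set⇒↭ (unique-map⁺ f injective unique) (range-unique 1 N) into from
    where
    into : ∀ {x} → x ∈ map f (endpoints D) → x ∈ range 1 N
    into x∈ with ∈-map⁻ f x∈
    ... | p , p∈ , refl = ∈-range⁺ (proj₁ (bounded p∈)) (s≤s (proj₂ (bounded p∈)))
    from : ∀ {x} → x ∈ range 1 N → x ∈ map f (endpoints D)
    from x∈ with onto (proj₁ (∈-range⁻ x∈)) (≤-pred (proj₂ (∈-range⁻ x∈)))
    ... | p , p∈ , refl = ∈-map⁺ f p∈

Nested : Chord → Chord → Set
Nested d e = proj₁ d < proj₁ e × proj₂ e < proj₂ d

nested-if-endpoint-inside : ∀ d e {q} → proj₁ e < proj₂ e → proj₁ e ≢ proj₁ d → proj₂ e ≢ proj₂ d →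
  ¬ Cross d e → ¬ Cross e d → q ∈ᶜ e → proj₁ d < q → q < proj₂ d → Nested d e
nested-if-endpoint-inside d e _ _ e₂≢d₂ ¬d×e _ (inj₁ refl) d₁<q q<d₂ with <-cmp (proj₂ e) (proj₂ d)
... | tri< e₂<d₂ _ _ = d₁<q , e₂<d₂
... | tri≈ _ e₂≡d₂ _ = ⊥-elim (e₂≢d₂ e₂≡d₂)
... | tri> _ _ d₂<e₂ = ⊥-elim (¬d×e (inj₁ (d₁<q , q<d₂ , d₂<e₂)))
nested-if-endpoint-inside d e _ e₁≢d₁ _ _ ¬e×d (inj₂ refl) d₁<q q<d₂ with <-cmp (proj₁ e) (proj₁ d)
... | tri< e₁<d₁ _ _ = ⊥-elim (¬e×d (inj₁ (e₁<d₁ , d₁<q , q<d₂)))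
... | tri≈ _ e₁≡d₁ _ = ⊥-elim (e₁≢d₁ e₁≡d₁)
... | tri> _ _ d₁<e₁ = d₁<e₁ , q<d₂

crossing-endpoint-inside : ∀ {x y} → Cross x y → ∃ λ q → q ∈ᶜ y × proj₁ x < q × q < proj₂ x
crossing-endpoint-inside (inj₁ (a , b , _)) = _ , inj₁ refl , a , b
crossing-endpoint-inside (inj₂ (_ , b , c)) = _ , inj₂ refl , b , c

path-last-step : ∀ {C : List Chord} {a b} → a ∈ C → Path C a b → a ≡ b ⊎ (∃ λ x → x ∈ C × Cross x b)
path-last-step a∈ here = inj₁ refl
path-last-step {a = a} a∈ (step d∈ x p) with path-last-step d∈ p
... | inj₁ refl = inj₂ (a , a∈ , x)
... | inj₂ last = inj₂ last

record ComponentSplit (X : List Chord) (c : Chord) : Set where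
  field
    S rest      : List Chord
    partition   : S ++ rest ↭ X
    c∈S         : c ∈ S
    path-from-c : ∀ {s} → s ∈ S → Path S c s
    uncrossed   : ∀ {d s} → d ∈ rest → s ∈ S → ¬ Cross s d

module _ (X : List Chord) (c : Chord) where

  private
    Invariant : List Chord → List Chord → Set
    Invariant S rest = (S ++ rest ↭ X) × c ∈ S × (∀ {s} → s ∈ S → Path S c s)

    length-mid : ∀ (pre : List Chord) {d post} → length (pre ++ d ∷ post) ≡ suc (length (pre ++ post))
    length-mid pre {d} {post} =
      trans (length-++ pre) (trans (+-suc (length pre) (length post)) (cong suc (sym (length-++ pre))))

    absorb : ∀ {S pre d post s} → Invariant S (pre ++ d ∷ post) → s ∈ S → Cross s d →
             Invariant (d ∷ S) (pre ++ post)
    absorb {S} {pre} {d} {post} (partition , c∈S , paths) s∈ s×d =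
      ↭-trans (↭-sym (subst₂ _↭_ (++-assoc S pre (d ∷ post)) (cong (d ∷_) (++-assoc S pre post))
                                 (shift d (S ++ pre) post))) partition ,
      there c∈S , paths′
      where
      paths′ : ∀ {s′} → s′ ∈ d ∷ S → Path (d ∷ S) c s′
      paths′ (here refl) = path-++ (path-mono there (paths s∈)) (step (here refl) s×d here)
      paths′ (there s′∈) = path-mono there (paths s′∈)

    grow : ∀ n S rest → length rest ≡ n → Invariant S rest → ComponentSplit X c
    grow n S rest len inv with any? (λ d → any? (λ s → Cross? s d) S) rest
    ... | no none = record
      { S = S ; rest = rest ; partition = proj₁ inv ; c∈S = proj₁ (proj₂ inv)
      ; path-from-c = proj₂ (proj₂ inv) ; uncrossed = λ d∈ s∈ s×d → none (lose d∈ (lose s∈ s×d)) }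
    ... | yes some with find some
    ...   | d , d∈ , crossed with find crossed | ∈-∃++ d∈
    grow zero    S _ len inv | yes _ | _ | _ | pre , post , refl = ⊥-elim (1+n≢0 (trans (sym (length-mid pre)) len))
    grow (suc n) S _ len inv | yes _ | d , _ | s , s∈ , s×d | pre , post , refl =
      grow n (d ∷ S) (pre ++ post) (suc-injective (trans (sym (length-mid pre)) len)) (absorb inv s∈ s×d)

  opaque
    componentSplit : c ∈ X → ComponentSplit X c
    componentSplit c∈ with ∈-∃++ c∈
    ... | pre , post , refl =
      grow _ (c ∷ []) (pre ++ post) refl (↭-sym (shift c pre post) , here refl , λ { (here refl) → here })

module Decompose {n : ℕ} {C : List Chord} (D : DiagramOn (2 * n) C) (conn : Connected C) (2≤n : 2 ≤ n) where

  open Diagram D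

  L : ℕ
  L = 2 * n

  3≤L : 3 ≤ L
  3≤L = ≤-trans (s≤s (s≤s (s≤s z≤n))) (*-monoʳ-≤ 2 2≤n)

  2≤L : 2 ≤ L
  2≤L = ≤-trans (n≤1+n 2) 3≤L

  1≤L : 1 ≤ L
  1≤L = ≤-trans (n≤1+n 1) 2≤L

  R : ℕ
  R = rootEnd C

  r : Chord
  r = 1 , R

  r∈C : r ∈ C
  r∈C = root∈ 1≤L

  X : List Chord
  X = nonRoot C

  C↭r∷X : C ↭ r ∷ X
  C↭r∷X = ↭-root∷nonRoot 1≤L

  ∈C⁻ : ∀ {x} → x ∈ C → x ≡ r ⊎ x ∈ X
  ∈C⁻ x∈ with ∈-resp-↭ C↭r∷X x∈
  ... | here x≡r  = inj₁ x≡r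
  ... | there x∈X = inj₂ x∈X

  X⊆C : ∀ {x} → x ∈ X → x ∈ C
  X⊆C x∈ = proj₁ (∈-nonRoot⁻ C x∈)

  X-start≢1 : ∀ {x} → x ∈ X → proj₁ x ≢ 1
  X-start≢1 x∈ = proj₂ (∈-nonRoot⁻ C x∈)

  X-start≥2 : ∀ {x} → x ∈ X → 2 ≤ proj₁ x
  X-start≥2 x∈ = ≤∧≢⇒< (start≥1 (X⊆C x∈)) (X-start≢1 x∈ ∘ sym)

  X-end≤L : ∀ {x} → x ∈ X → proj₂ x ≤ L
  X-end≤L = end≤ ∘ X⊆C

  X-ordered : ∀ {x} → x ∈ X → proj₁ x < proj₂ x
  X-ordered = start<end ∘ X⊆C

  X-same-chord : ∀ {x y p} → x ∈ X → y ∈ X → p ∈ᶜ x → p ∈ᶜ y → x ≡ y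
  X-same-chord x∈ y∈ = same-chord (X⊆C x∈) (X⊆C y∈)

  R∉X : ∀ {x} → x ∈ X → ¬ R ∈ᶜ x
  R∉X x∈ R∈x = X-start≢1 x∈ (cong proj₁ (same-chord (X⊆C x∈) r∈C R∈x (inj₂ refl)))

  1<R : 1 < R
  1<R = start<end r∈C

  R≤L : R ≤ L
  R≤L = end≤ r∈C

  opaque
    -- If the root chord were (1 , 2), no chord could cross it.
    chord-at-2 : ∃ λ c → c ∈ X × proj₁ c ≡ 2
    chord-at-2 with chord-at {2} (s≤s z≤n) 2≤L
    ... | c , c∈ , inj₁ 2≡c₁ with ∈C⁻ c∈
    ...   | inj₁ refl = ⊥-elim (1+n≢n 2≡c₁)
    ...   | inj₂ c∈X  = c , c∈X , sym 2≡c₁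
    chord-at-2 | c , c∈ , inj₂ 2≡c₂ = ⊥-elim root-uncrossed
      where
      c₁≡1 : proj₁ c ≡ 1
      c₁≡1 = ≤-antisym (≤-pred (subst (proj₁ c <_) (sym 2≡c₂) (start<end c∈))) (start≥1 c∈)
      R≡2 : R ≡ 2
      R≡2 = trans (cong proj₂ (sym (root-unique 1≤L c∈ c₁≡1))) (sym 2≡c₂)
      root-uncrossed : ⊥
      root-uncrossed with chord-at {3} (s≤s z≤n) 3≤L
      ... | d , d∈ , 3∈d with path-last-step d∈ (conn d∈ r∈C)
      ...   | inj₁ refl with 3∈d
      ...     | inj₂ 3≡R = 1+n≢n (trans 3≡R R≡2)
      root-uncrossed | d , d∈ , 3∈d | inj₂ (x , x∈ , inj₁ (x₁<1 , _)) = <⇒≱ x₁<1 (start≥1 x∈)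
      root-uncrossed | d , d∈ , 3∈d | inj₂ (x , x∈ , inj₂ (1<x₁ , x₁<R , _)) =
        <⇒≱ x₁<R (subst (_≤ proj₁ x) (sym R≡2) 1<x₁)

  c₂ : Chord
  c₂ = proj₁ chord-at-2

  c₂∈X : c₂ ∈ X
  c₂∈X = proj₁ (proj₂ chord-at-2)

  c₂-starts-at-2 : proj₁ c₂ ≡ 2
  c₂-starts-at-2 = proj₂ (proj₂ chord-at-2)

  open ComponentSplit (componentSplit X c₂ c₂∈X) public renaming (c∈S to c₂∈S)

  S⊆X : ∀ {x} → x ∈ S → x ∈ X
  S⊆X x∈ = ∈-resp-↭ partition (∈-++⁺ˡ x∈)

  rest⊆X : ∀ {x} → x ∈ rest → x ∈ X
  rest⊆X x∈ = ∈-resp-↭ partition (∈-++⁺ʳ S x∈)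

  ∈X⁻ : ∀ {x} → x ∈ X → x ∈ S ⊎ x ∈ rest
  ∈X⁻ x∈ = ∈-++⁻ S (∈-resp-↭ (↭-sym partition) x∈)

  S-disjoint-rest : ∀ {x} → x ∈ S → x ∉ rest
  S-disjoint-rest = unique-++-disjoint S (unique-resp-↭ (↭-sym partition) X-unique)
    where
    X-unique : Unique X
    X-unique with unique-resp-↭ C↭r∷X unique
    ... | _ ∷ u = u

  E : List ℕ
  E = endpoints S

  rest-endpoint∉E : ∀ {d q} → d ∈ rest → q ∈ᶜ d → q ∉ E
  rest-endpoint∉E d∈ q∈d q∈E with ∈-endpoints⁻ S q∈E
  ... | s , s∈ , q∈s with X-same-chord (S⊆X s∈) (rest⊆X d∈) q∈s q∈d
  ...   | refl = S-disjoint-rest s∈ d∈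

  R∉E : R ∉ E
  R∉E R∈E with ∈-endpoints⁻ S R∈E
  ... | s , s∈ , R∈s = R∉X (S⊆X s∈) R∈s

  -- A chord of rest surrounding a point of E would, by propagation along crossings,
  -- surround c₂, which starts at 2.
  E-not-surrounded : ∀ {d} → d ∈ rest → ∀ {q} → q ∈ E → proj₁ d < q → q < proj₂ d → ⊥
  E-not-surrounded {d} d∈ q∈E d₁<q q<d₂ with ∈-endpoints⁻ S q∈E
  ... | e , e∈ , q∈e with propagate e∈ (nested e∈ q∈e d₁<q q<d₂) (path-reverse c₂∈S (path-from-c e∈))
    where
    nested : ∀ {y q} → y ∈ S → q ∈ᶜ y → proj₁ d < q → q < proj₂ d → Nested d y
    nested {y} y∈ = nested-if-endpoint-inside d y (X-ordered (S⊆X y∈))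
      (λ y₁≡d₁ → distinct (X-same-chord (S⊆X y∈) (rest⊆X d∈) (inj₁ refl) (inj₁ y₁≡d₁)))
      (λ y₂≡d₂ → distinct (X-same-chord (S⊆X y∈) (rest⊆X d∈) (inj₂ refl) (inj₂ y₂≡d₂)))
      (uncrossed d∈ y∈ ∘ Cross-sym) (uncrossed d∈ y∈)
      where
      distinct : y ≢ d
      distinct refl = S-disjoint-rest y∈ d∈
    propagate : ∀ {x y} → x ∈ S → Nested d x → Path S x y → Nested d y
    propagate x∈ d⊃x here = d⊃x
    propagate x∈ (d₁<x₁ , x₂<d₂) (step y∈ x×y p) with crossing-endpoint-inside x×y
    ... | q , q∈y , x₁<q , q<x₂ = propagate y∈ (nested y∈ q∈y (<-trans d₁<x₁ x₁<q) (<-trans q<x₂ x₂<d₂)) p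
  ... | d₁<2 , _ = <⇒≱ (subst (proj₁ d <_) c₂-starts-at-2 d₁<2) (X-start≥2 (rest⊆X d∈))

  opaque
    crossing-root-in-S : ∃ λ s → s ∈ S × Cross s r
    crossing-root-in-S = go c₂∈S (conn (X⊆C (S⊆X c₂∈S)) r∈C)
      where
      go : ∀ {x} → x ∈ S → Path C x r → ∃ λ s → s ∈ S × Cross s r
      go x∈ here = ⊥-elim (X-start≢1 (S⊆X x∈) refl)
      go {x} x∈ (step y∈ x×y p) with ∈C⁻ y∈
      ... | inj₁ refl = x , x∈ , x×y
      ... | inj₂ y∈X with ∈X⁻ y∈X
      ...   | inj₁ y∈S    = go y∈S p
      ...   | inj₂ y∈rest = ⊥-elim (uncrossed y∈rest x∈ x×y)

  s* : Chord
  s* = proj₁ crossing-root-in-S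

  s*∈S : s* ∈ S
  s*∈S = proj₁ (proj₂ crossing-root-in-S)

  s*-straddles-R : proj₁ s* < R × R < proj₂ s*
  s*-straddles-R with proj₂ (proj₂ crossing-root-in-S)
  ... | inj₁ (s₁<1 , _) = ⊥-elim (<⇒≱ s₁<1 (≤-trans (n≤1+n 1) (X-start≥2 (S⊆X s*∈S))))
  ... | inj₂ (_ , s₁<R , R<s₂) = s₁<R , R<s₂

  private
    s₁≤pred-R : proj₁ s* ≤ pred R
    s₁≤pred-R = suc[m]≤n⇒m≤pred[n] (proj₁ s*-straddles-R)

    greatest : GreatestIn (_∈ E) (proj₁ s*) (proj₁ s* + (pred R ∸ proj₁ s*))
    greatest = greatest-in (_∈ E) (_∈? E) (pred R ∸ proj₁ s*) (∈-endpoints⁺ s*∈S (inj₁ refl))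

    least : LeastIn (_∈ E) (suc R) (suc R + (proj₂ s* ∸ suc R))
    least = least-in (_∈ E) (_∈? E) (proj₂ s* ∸ suc R)
      (subst (_∈ E) (sym (m+[n∸m]≡n (proj₂ s*-straddles-R))) (∈-endpoints⁺ s*∈S (inj₂ refl)))

    module Lo = GreatestIn greatest
    module Hi = LeastIn least

  e₁ e₂ : ℕ
  e₁ = Lo.value
  e₂ = Hi.value

  e₁∈E : e₁ ∈ E
  e₁∈E = Lo.holds

  e₂∈E : e₂ ∈ E
  e₂∈E = Hi.holds

  e₁<R : e₁ < R
  e₁<R = m≤pred[n]⇒suc[m]≤n {{>-nonZero (<-trans z<s 1<R)}} (subst (e₁ ≤_) (m+[n∸m]≡n s₁≤pred-R) Lo.value≤hi)

  R<e₂ : R < e₂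
  R<e₂ = Hi.lo≤value

  e₁<e₂ : e₁ < e₂
  e₁<e₂ = <-trans e₁<R R<e₂

  e₁≥2 : 2 ≤ e₁
  e₁≥2 = ≤-trans (X-start≥2 (S⊆X s*∈S)) Lo.lo≤value

  e₂≤L : e₂ ≤ L
  e₂≤L = ≤-trans (subst (e₂ ≤_) (m+[n∸m]≡n (proj₂ s*-straddles-R)) Hi.value≤hi) (X-end≤L (S⊆X s*∈S))

  gap : ∀ q → e₁ < q → q < e₂ → q ∉ E
  gap q e₁<q q<e₂ with <-cmp q R
  ... | tri< q<R _ _ = Lo.none-above q e₁<q (subst (q ≤_) (sym (m+[n∸m]≡n s₁≤pred-R)) (suc[m]≤n⇒m≤pred[n] q<R))
  ... | tri≈ _ refl _ = R∉E
  ... | tri> _ _ R<q = Hi.none-below q R<q q<e₂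

  within-gap : ∀ {d} → d ∈ rest → ∀ p → proj₁ d < p → p < proj₂ d → e₁ < p → p < e₂ →
               e₁ < proj₁ d × proj₂ d < e₂
  within-gap {d} d∈ p d₁<p p<d₂ e₁<p p<e₂ = e₁<d₁ , d₂<e₂
    where
    e₁<d₁ : e₁ < proj₁ d
    e₁<d₁ with <-cmp e₁ (proj₁ d)
    ... | tri< e₁<d₁ _ _ = e₁<d₁
    ... | tri≈ _ e₁≡d₁ _ = ⊥-elim (rest-endpoint∉E d∈ (inj₁ e₁≡d₁) e₁∈E)
    ... | tri> _ _ d₁<e₁ = ⊥-elim (E-not-surrounded d∈ e₁∈E d₁<e₁ (<-trans e₁<p p<d₂))
    d₂<e₂ : proj₂ d < e₂
    d₂<e₂ with <-cmp (proj₂ d) e₂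
    ... | tri< d₂<e₂ _ _ = d₂<e₂
    ... | tri≈ _ d₂≡e₂ _ = ⊥-elim (rest-endpoint∉E d∈ (inj₂ refl) (subst (_∈ E) (sym d₂≡e₂) e₂∈E))
    ... | tri> _ _ e₂<d₂ = ⊥-elim (E-not-surrounded d∈ e₂∈E (<-trans d₁<p p<e₂) e₂<d₂)

  -- Working back from r along the path, each chord surrounds an endpoint of its successor, which
  -- lies in the gap (for the last chord this point is R), so within-gap applies.
  rest-to-root : ∀ {d} → d ∈ rest → Path C d r → (e₁ < proj₁ d × proj₂ d < e₂) × Path (r ∷ rest) d r
  rest-to-root d∈ here = ⊥-elim (X-start≢1 (rest⊆X d∈) refl)
  rest-to-root {d} d∈ (step y∈ d×y p) with ∈C⁻ y∈
  ... | inj₁ refl = in-gap d×y , step (here refl) d×y here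
    where
    in-gap : Cross d r → e₁ < proj₁ d × proj₂ d < e₂
    in-gap (inj₁ (d₁<1 , _)) = ⊥-elim (<⇒≱ d₁<1 (≤-trans (n≤1+n 1) (X-start≥2 (rest⊆X d∈))))
    in-gap (inj₂ (_ , d₁<R , R<d₂)) = within-gap d∈ R d₁<R R<d₂ e₁<R R<e₂
  ... | inj₂ y∈X with ∈X⁻ y∈X
  ...   | inj₁ y∈S = ⊥-elim (uncrossed d∈ y∈S (Cross-sym d×y))
  ...   | inj₂ y∈rest with rest-to-root y∈rest p | crossing-endpoint-inside d×y
  ...     | (e₁<y₁ , y₂<e₂) , path | q , q∈y , d₁<q , q<d₂ =
    within-gap d∈ q d₁<q q<d₂ (e₁<q q∈y) (q<e₂ q∈y) , step (there y∈rest) d×y path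
    where
    e₁<q : ∀ {q} → q ∈ᶜ _ → e₁ < q
    e₁<q (inj₁ refl) = e₁<y₁
    e₁<q (inj₂ refl) = <-trans e₁<y₁ (X-ordered (rest⊆X y∈rest))
    q<e₂ : ∀ {q} → q ∈ᶜ _ → q < e₂
    q<e₂ (inj₁ refl) = <-trans (X-ordered (rest⊆X y∈rest)) y₂<e₂
    q<e₂ (inj₂ refl) = y₂<e₂

  rest-in-gap : ∀ {d q} → d ∈ rest → q ∈ᶜ d → e₁ < q × q < e₂
  rest-in-gap d∈ q∈d with proj₁ (rest-to-root d∈ (conn (X⊆C (rest⊆X d∈)) r∈C)) | q∈d
  ... | e₁<d₁ , d₂<e₂ | inj₁ refl = e₁<d₁ , <-trans (X-ordered (rest⊆X d∈)) d₂<e₂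
  ... | e₁<d₁ , d₂<e₂ | inj₂ refl = <-trans e₁<d₁ (X-ordered (rest⊆X d∈)) , d₂<e₂

  rest-path-to-root : ∀ {d} → d ∈ rest → Path (r ∷ rest) d r
  rest-path-to-root d∈ = proj₂ (rest-to-root d∈ (conn (X⊆C (rest⊆X d∈)) r∈C))

  point-owner : ∀ {q} → 2 ≤ q → q ≤ L → q ∈ E ⊎ q ≡ R ⊎ (∃ λ d → d ∈ rest × q ∈ᶜ d)
  point-owner {q} 2≤q q≤L with chord-at (≤-trans (n≤1+n 1) 2≤q) q≤L
  ... | c , c∈ , q∈c with ∈C⁻ c∈
  ...   | inj₁ refl = inj₂ (inj₁ (from-root q∈c))
    where
    from-root : q ∈ᶜ r → q ≡ R
    from-root (inj₁ refl) = ⊥-elim (<-irrefl refl 2≤q)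
    from-root (inj₂ q≡R)  = q≡R
  ...   | inj₂ c∈X with ∈X⁻ c∈X
  ...     | inj₁ c∈S    = inj₁ (∈-endpoints⁺ c∈S q∈c)
  ...     | inj₂ c∈rest = inj₂ (inj₂ (c , c∈rest , q∈c))

  E-below-gap : ∀ {q} → 2 ≤ q → q ≤ e₁ → q ∈ E
  E-below-gap {q} 2≤q q≤e₁ with point-owner 2≤q (≤-trans q≤e₁ (≤-trans (<⇒≤ e₁<R) R≤L))
  ... | inj₁ q∈E                    = q∈E
  ... | inj₂ (inj₁ refl)            = ⊥-elim (<⇒≱ e₁<R q≤e₁)
  ... | inj₂ (inj₂ (d , d∈ , q∈d)) = ⊥-elim (<⇒≱ (proj₁ (rest-in-gap d∈ q∈d)) q≤e₁)

  E-above-gap : ∀ {q} → e₂ ≤ q → q ≤ L → q ∈ E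
  E-above-gap {q} e₂≤q q≤L with point-owner (≤-trans (≤-trans e₁≥2 (<⇒≤ e₁<e₂)) e₂≤q) q≤L
  ... | inj₁ q∈E                    = q∈E
  ... | inj₂ (inj₁ refl)            = ⊥-elim (<⇒≱ R<e₂ e₂≤q)
  ... | inj₂ (inj₂ (d , d∈ , q∈d)) = ⊥-elim (<⇒≱ (proj₂ (rest-in-gap d∈ q∈d)) e₂≤q)

  E-outside-gap : ∀ {q} → q ∈ E → 2 ≤ q × q ≤ L × (q ≤ e₁ ⊎ e₂ ≤ q)
  E-outside-gap {q} q∈E with ∈-endpoints⁻ S q∈E
  ... | s , s∈ , q∈s = 2≤q q∈s , q≤L q∈s , side
    where
    2≤q : q ∈ᶜ s → 2 ≤ q
    2≤q (inj₁ refl) = X-start≥2 (S⊆X s∈)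
    2≤q (inj₂ refl) = ≤-trans (X-start≥2 (S⊆X s∈)) (<⇒≤ (X-ordered (S⊆X s∈)))
    q≤L : q ∈ᶜ s → q ≤ L
    q≤L (inj₁ refl) = ≤-trans (<⇒≤ (X-ordered (S⊆X s∈))) (X-end≤L (S⊆X s∈))
    q≤L (inj₂ refl) = X-end≤L (S⊆X s∈)
    side : q ≤ e₁ ⊎ e₂ ≤ q
    side with q ≤? e₁ | e₂ ≤? q
    ... | yes q≤e₁ | _        = inj₁ q≤e₁
    ... | no _     | yes e₂≤q = inj₂ e₂≤q
    ... | no q≰e₁  | no e₂≰q  = ⊥-elim (gap q (≰⇒> q≰e₁) (≰⇒> e₂≰q) q∈E)

  i g N'' : ℕ
  i   = pred e₁
  g   = e₂ ∸ e₁
  N'' = L ∸ g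

  e₁≡1+i : e₁ ≡ suc i
  e₁≡1+i = sym (suc-pred e₁ {{>-nonZero (≤-trans (n≤1+n 1) e₁≥2)}})

  1≤i : 1 ≤ i
  1≤i = ≤-pred (subst (2 ≤_) e₁≡1+i e₁≥2)

  e₂≡e₁+g : e₂ ≡ e₁ + g
  e₂≡e₁+g = sym (m+[n∸m]≡n (<⇒≤ e₁<e₂))

  e₂≡1+i+g : e₂ ≡ suc i + g
  e₂≡1+i+g = trans e₂≡e₁+g (cong (_+ g) e₁≡1+i)

  1≤g : 1 ≤ g
  1≤g = m<n⇒0<n∸m e₁<e₂

  g≤L : g ≤ L
  g≤L = ≤-trans (m≤n+m g e₁) (subst (_≤ L) e₂≡e₁+g e₂≤L)

  e₁≤N'' : e₁ ≤ N''
  e₁≤N'' = m+n≤o⇒m≤o∸n e₁ (subst (_≤ L) e₂≡e₁+g e₂≤L)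

  i<e₁ : i < e₁
  i<e₁ = subst (i <_) (sym e₁≡1+i) ≤-refl

  innerUnshift : ℕ → ℕ
  innerUnshift p = if p ≤ᵇ i then 1 else p ∸ i

  outerUnshift : ℕ → ℕ
  outerUnshift p = if p ≤ᵇ e₁ then p ∸ 1 else p ∸ g

  inner₀ outer₀ : List Chord
  inner₀ = map (mapChord innerUnshift) (r ∷ rest)
  outer₀ = map (mapChord outerUnshift) S

  private
    all-endpoints-unique : Unique (1 ∷ R ∷ (endpoints S ++ endpoints rest))
    all-endpoints-unique = subst (λ l → Unique (1 ∷ R ∷ l)) (endpoints-++ S rest)
      (unique-resp-↭ (endpoints-↭ (↭-trans C↭r∷X (↭prep r (↭-sym partition)))) endpoints-unique)

  S-endpoints-unique : Unique (endpoints S)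
  S-endpoints-unique with all-endpoints-unique
  ... | _ ∷ _ ∷ u = unique-++⁻ˡ (endpoints S) u

  r∷rest-endpoints-unique : Unique (endpoints (r ∷ rest))
  r∷rest-endpoints-unique =
    unique-++⁻ʳ (endpoints S) (unique-resp-↭ (shifts (1 ∷ R ∷ []) (endpoints S)) all-endpoints-unique)

  r∷rest-points : ∀ {p} → p ∈ endpoints (r ∷ rest) → p ≡ 1 ⊎ (e₁ < p × p < e₂)
  r∷rest-points (here p≡1)         = inj₁ p≡1
  r∷rest-points (there (here refl)) = inj₂ (e₁<R , R<e₂)
  r∷rest-points (there (there p∈)) with ∈-endpoints⁻ rest p∈
  ... | d , d∈ , p∈d = inj₂ (rest-in-gap d∈ p∈d)

  innerUnshift-1 : innerUnshift 1 ≡ 1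
  innerUnshift-1 = if-≤ᵇ-≤ 1≤i

  innerUnshift-> : ∀ {p} → e₁ < p → innerUnshift p ≡ p ∸ i
  innerUnshift-> e₁<p = if-≤ᵇ-> (<-trans i<e₁ e₁<p)

  2≤innerUnshift : ∀ {p} → e₁ < p → 2 ≤ innerUnshift p
  2≤innerUnshift {p} e₁<p = subst (2 ≤_) (sym (innerUnshift-> e₁<p))
    (subst (_≤ p ∸ i) (m+n∸n≡m 2 i) (∸-monoˡ-≤ i (subst (_< p) e₁≡1+i e₁<p)))

  innerShift-innerUnshift : ∀ {p} → e₁ < p → innerUnshift p + i ≡ p
  innerShift-innerUnshift {p} e₁<p =
    trans (cong (_+ i) (innerUnshift-> e₁<p)) (m∸n+n≡m (<⇒≤ (<-trans i<e₁ e₁<p)))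

  innerUnshift-< : ∀ {p q} → p ∈ endpoints (r ∷ rest) → q ∈ endpoints (r ∷ rest) → p < q →
                   innerUnshift p < innerUnshift q
  innerUnshift-< {p} {q} p∈ q∈ p<q with r∷rest-points p∈ | r∷rest-points q∈
  ... | inj₁ refl         | inj₁ refl         = ⊥-elim (<-irrefl refl p<q)
  ... | inj₁ refl         | inj₂ (e₁<q , _)   = subst (_< innerUnshift q) (sym innerUnshift-1) (2≤innerUnshift e₁<q)
  ... | inj₂ (e₁<p , _)   | inj₁ refl         =
    ⊥-elim (<⇒≱ p<q (≤-trans (n≤1+n 1) (≤-trans e₁≥2 (<⇒≤ e₁<p))))
  ... | inj₂ (e₁<p , _)   | inj₂ (e₁<q , _)   =
    subst₂ _<_ (sym (innerUnshift-> e₁<p)) (sym (innerUnshift-> e₁<q)) (∸-monoˡ-< p<q (<⇒≤ (<-trans i<e₁ e₁<p)))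

  innerUnshift-bounds : ∀ {p} → p ∈ endpoints (r ∷ rest) → 1 ≤ innerUnshift p × innerUnshift p ≤ g
  innerUnshift-bounds p∈ with r∷rest-points p∈
  ... | inj₁ refl = subst (1 ≤_) (sym innerUnshift-1) ≤-refl , subst (_≤ g) (sym innerUnshift-1) 1≤g
  ... | inj₂ (e₁<p , p<e₂) = ≤-trans (n≤1+n 1) (2≤innerUnshift e₁<p) ,
    subst (_≤ g) (sym (innerUnshift-> e₁<p)) (m≤n+o⇒m∸n≤o _ i (≤-pred (subst (_ <_) e₂≡1+i+g p<e₂)))

  innerUnshift-onto : ∀ {q} → 1 ≤ q → q ≤ g → ∃ λ p → p ∈ endpoints (r ∷ rest) × innerUnshift p ≡ q
  innerUnshift-onto {q} 1≤q q≤g with q ≟ 1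
  ... | yes refl = 1 , here refl , innerUnshift-1
  ... | no q≢1   = q + i , q+i∈ , trans (innerUnshift-> e₁<q+i) (m+n∸n≡m q i)
    where
    e₁<q+i : e₁ < q + i
    e₁<q+i = subst (_< q + i) (sym e₁≡1+i) (+-monoˡ-≤ i (≤∧≢⇒< 1≤q (q≢1 ∘ sym)))
    q+i<e₂ : q + i < e₂
    q+i<e₂ = subst (q + i <_) (sym e₂≡1+i+g) (s≤s (subst (_≤ i + g) (+-comm i q) (+-monoʳ-≤ i q≤g)))
    q+i∈ : q + i ∈ endpoints (r ∷ rest)
    q+i∈ with point-owner (≤-trans e₁≥2 (<⇒≤ e₁<q+i)) (≤-trans (<⇒≤ q+i<e₂) e₂≤L)
    ... | inj₁ q+i∈E                   = ⊥-elim (gap _ e₁<q+i q+i<e₂ q+i∈E)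
    ... | inj₂ (inj₁ q+i≡R)            = there (here q+i≡R)
    ... | inj₂ (inj₂ (d , d∈ , q+i∈d)) = there (there (∈-endpoints⁺ d∈ q+i∈d))

  inner₀-diagram : DiagramOn g inner₀
  inner₀-diagram = map-diagramOn (r ∷ rest) innerUnshift g r∷rest-endpoints-unique
    (1<R ∷ tabulate (X-ordered ∘ rest⊆X)) innerUnshift-< innerUnshift-bounds innerUnshift-onto

  outerUnshift-≤ : ∀ {p} → p ≤ e₁ → outerUnshift p ≡ p ∸ 1
  outerUnshift-≤ = if-≤ᵇ-≤

  outerUnshift-≥ : ∀ {p} → e₂ ≤ p → outerUnshift p ≡ p ∸ g
  outerUnshift-≥ e₂≤p = if-≤ᵇ-> (<-≤-trans e₁<e₂ e₂≤p)

  e₁≤outerUnshift : ∀ {p} → e₂ ≤ p → e₁ ≤ outerUnshift p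
  e₁≤outerUnshift {p} e₂≤p = subst₂ _≤_ (trans (cong (_∸ g) e₂≡e₁+g) (m+n∸n≡m e₁ g))
    (sym (outerUnshift-≥ e₂≤p)) (∸-monoˡ-≤ g e₂≤p)

  g≤above-gap : ∀ {p} → e₂ ≤ p → g ≤ p
  g≤above-gap e₂≤p = ≤-trans (m≤n+m g e₁) (subst (_≤ _) e₂≡e₁+g e₂≤p)

  outerUnshift-< : ∀ {p q} → p ∈ E → q ∈ E → p < q → outerUnshift p < outerUnshift q
  outerUnshift-< {p} {q} p∈ q∈ p<q with E-outside-gap p∈ | E-outside-gap q∈
  ... | 2≤p , _ , inj₁ p≤e₁ | _ , _ , inj₁ q≤e₁ =
    subst₂ _<_ (sym (outerUnshift-≤ p≤e₁)) (sym (outerUnshift-≤ q≤e₁))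
               (∸-monoˡ-< p<q (≤-trans (n≤1+n 1) 2≤p))
  ... | 2≤p , _ , inj₁ p≤e₁ | _ , _ , inj₂ e₂≤q =
    <-≤-trans (subst (_< e₁) (sym (outerUnshift-≤ p≤e₁)) (<-≤-trans p∸1<p p≤e₁)) (e₁≤outerUnshift e₂≤q)
    where
    p∸1<p : p ∸ 1 < p
    p∸1<p = ∸-monoʳ-< {p} {1} {0} z<s (≤-trans (n≤1+n 1) 2≤p)
  ... | _ , _ , inj₂ e₂≤p | _ , _ , inj₁ q≤e₁ =
    ⊥-elim (<⇒≱ (<-≤-trans e₁<e₂ (≤-trans e₂≤p (<⇒≤ p<q))) q≤e₁)
  ... | _ , _ , inj₂ e₂≤p | _ , _ , inj₂ e₂≤q =
    subst₂ _<_ (sym (outerUnshift-≥ e₂≤p)) (sym (outerUnshift-≥ e₂≤q)) (∸-monoˡ-< p<q (g≤above-gap e₂≤p))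

  outerUnshift-bounds : ∀ {p} → p ∈ E → 1 ≤ outerUnshift p × outerUnshift p ≤ N''
  outerUnshift-bounds {p} p∈ with E-outside-gap p∈
  ... | 2≤p , _ , inj₁ p≤e₁ =
    subst (1 ≤_) (sym (outerUnshift-≤ p≤e₁)) (∸-monoˡ-≤ 1 2≤p) ,
    subst (_≤ N'') (sym (outerUnshift-≤ p≤e₁)) (≤-trans (m∸n≤m p 1) (≤-trans p≤e₁ e₁≤N''))
  ... | _ , p≤L , inj₂ e₂≤p =
    ≤-trans (≤-trans (n≤1+n 1) e₁≥2) (e₁≤outerUnshift e₂≤p) ,
    subst (_≤ N'') (sym (outerUnshift-≥ e₂≤p)) (∸-monoˡ-≤ g p≤L)

  outerUnshift-onto : ∀ {q} → 1 ≤ q → q ≤ N'' → ∃ λ p → p ∈ E × outerUnshift p ≡ q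
  outerUnshift-onto {q} 1≤q q≤N'' with q ≤? i
  ... | yes q≤i = suc q , E-below-gap (s≤s 1≤q) q+1≤e₁ , outerUnshift-≤ q+1≤e₁
    where
    q+1≤e₁ : suc q ≤ e₁
    q+1≤e₁ = subst (suc q ≤_) (sym e₁≡1+i) (s≤s q≤i)
  ... | no q≰i  = q + g , E-above-gap e₂≤q+g q+g≤L , trans (outerUnshift-≥ e₂≤q+g) (m+n∸n≡m q g)
    where
    e₂≤q+g : e₂ ≤ q + g
    e₂≤q+g = subst (_≤ q + g) (sym e₂≡e₁+g) (+-monoˡ-≤ g (subst (_≤ q) (sym e₁≡1+i) (≰⇒> q≰i)))
    q+g≤L : q + g ≤ L
    q+g≤L = subst (q + g ≤_) (m∸n+n≡m g≤L) (+-monoˡ-≤ g q≤N'')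

  outer₀-diagram : DiagramOn N'' outer₀
  outer₀-diagram = map-diagramOn S outerUnshift N'' S-endpoints-unique
    (tabulate (X-ordered ∘ S⊆X)) outerUnshift-< outerUnshift-bounds outerUnshift-onto

  inner₀-connected : Connected inner₀
  inner₀-connected = connected-via (here refl) to-root
    where
    to-root : ∀ {c} → c ∈ inner₀ → Path inner₀ c (mapChord innerUnshift r)
    to-root c∈ with ∈-map⁻ (mapChord innerUnshift) c∈
    ... | _ , here refl , refl = here
    ... | _ , there d∈ , refl  = path-map (mapChord innerUnshift) (∈-map⁺ (mapChord innerUnshift))
      (Cross-map-endpoints innerUnshift innerUnshift-<) (there d∈) (rest-path-to-root d∈)

  outer₀-connected : Connected outer₀
  outer₀-connected = connected-via c₂′∈ to-c₂′
    where
    c₂′∈ : mapChord outerUnshift c₂ ∈ outer₀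
    c₂′∈ = ∈-map⁺ (mapChord outerUnshift) c₂∈S
    to-c₂′ : ∀ {c} → c ∈ outer₀ → Path outer₀ c (mapChord outerUnshift c₂)
    to-c₂′ c∈ with ∈-map⁻ (mapChord outerUnshift) c∈
    ... | s , s∈ , refl = path-reverse c₂′∈
      (path-map (mapChord outerUnshift) (∈-map⁺ (mapChord outerUnshift))
                (Cross-map-endpoints outerUnshift outerUnshift-<) c₂∈S (path-from-c s∈))

  m' n'' : ℕ
  m'  = length inner₀
  n'' = length outer₀

  2*m'≡g : 2 * m' ≡ g
  2*m'≡g = Diagram.2*length inner₀-diagram

  2*n''≡N'' : 2 * n'' ≡ N''
  2*n''≡N'' = Diagram.2*length outer₀-diagram

  1≤m' : 1 ≤ m'
  1≤m' = s≤s z≤n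

  1≤n'' : 1 ≤ n''
  1≤n'' = subst (1 ≤_) (sym (length-map (mapChord outerUnshift) S)) (nonempty c₂∈S)
    where
    nonempty : ∀ {x} {xs : List Chord} → x ∈ xs → 1 ≤ length xs
    nonempty (here _)  = s≤s z≤n
    nonempty (there _) = s≤s z≤n

  n''+m'≡n : n'' + m' ≡ n
  n''+m'≡n = *-cancelˡ-≡ (n'' + m') n 2
    (trans (*-distribˡ-+ 2 n'' m') (trans (cong₂ _+_ 2*n''≡N'' 2*m'≡g) (m∸n+n≡m g≤L)))

  m'<n : m' < n
  m'<n = subst (m' <_) n''+m'≡n (+-monoˡ-≤ m' 1≤n'')

  n''<n : n'' < n
  n''<n = subst (n'' <_) n''+m'≡n (subst (_≤ n'' + m') (+-comm n'' 1) (+-monoʳ-≤ n'' 1≤m'))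

module Reassemble {n : ℕ} {C : List Chord} (D : DiagramOn (2 * n) C) (conn : Connected C) (2≤n : 2 ≤ n)
  {t' t'' : PTree} (τ' : Tubing t') (τ'' : Tubing t'')
  (size-t' : size t' ≡ Decompose.m' D conn 2≤n) (θτ'↭ : θ τ' ↭ Decompose.inner₀ D conn 2≤n)
  (size-t'' : size t'' ≡ Decompose.n'' D conn 2≤n) (θτ''↭ : θ τ'' ↭ Decompose.outer₀ D conn 2≤n) where

  open Decompose D conn 2≤n

  suc-pred-i : suc (pred i) ≡ i
  suc-pred-i = suc-pred i {{>-nonZero 1≤i}}

  pred-i<places : pred i < places t''
  pred-i<places = ≤-pred (subst (_≤ suc (places t'')) (sym (cong suc suc-pred-i))
    (subst (suc i ≤_) (sym (trans (suc-places t'') (trans (cong (2 *_) size-t'') 2*n''≡N'')))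
      (subst (_≤ N'') e₁≡1+i e₁≤N'')))

  opaque
    insertion-place : Σ (Fin (places t'')) λ j → toℕ j ≡ pred i
    insertion-place = fromℕ< pred-i<places , toℕ-fromℕ< pred-i<places

  j : Fin (places t'')
  j = proj₁ insertion-place

  module J = JoinOf τ' τ'' j

  J-i≡i : J.i ≡ i
  J-i≡i = trans (cong suc (proj₂ insertion-place)) suc-pred-i

  J-m≡m' : J.m ≡ m'
  J-m≡m' = ↭-length θτ'↭

  J-sh≡ : ∀ p → J.sh p ≡ outerShift i m' p
  J-sh≡ p = cong₂ (λ a b → outerShift a b p) J-i≡i J-m≡m'

  root-end : J.k + J.i ≡ R
  root-end with ∈-map⁻ (mapChord innerUnshift) (∈-resp-↭ θτ'↭ J.root∈C')
  ... | _ , here refl , eq = trans (cong₂ _+_ (cong proj₂ eq) J-i≡i) (innerShift-innerUnshift e₁<R)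
  ... | _ , there d∈ , eq  =
    ⊥-elim (<-irrefl (cong proj₁ eq) (2≤innerUnshift (proj₁ (rest-in-gap d∈ (inj₁ refl)))))

  outerShift-outerUnshift : ∀ {p} → p ∈ E → J.sh (outerUnshift p) ≡ p
  outerShift-outerUnshift {p} p∈ with E-outside-gap p∈
  ... | 2≤p , _ , inj₁ p≤e₁ = begin
    J.sh (outerUnshift p)            ≡⟨ J-sh≡ (outerUnshift p) ⟩
    outerShift i m' (outerUnshift p) ≡⟨ cong (outerShift i m') (outerUnshift-≤ p≤e₁) ⟩
    outerShift i m' (p ∸ 1)          ≡⟨ outerShift-≤ {i} {m'} p∸1≤i ⟩
    suc (p ∸ 1)                      ≡⟨ suc-pred p {{>-nonZero (≤-trans (n≤1+n 1) 2≤p)}} ⟩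
    p                                ∎
    where
    open ≡-Reasoning
    p∸1≤i : p ∸ 1 ≤ i
    p∸1≤i = subst (p ∸ 1 ≤_) (cong (_∸ 1) e₁≡1+i) (∸-monoˡ-≤ 1 p≤e₁)
  ... | _ , _ , inj₂ e₂≤p = begin
    J.sh (outerUnshift p)            ≡⟨ J-sh≡ (outerUnshift p) ⟩
    outerShift i m' (outerUnshift p) ≡⟨ outerShift-> {i} {m'} i<p′ ⟩
    outerUnshift p + 2 * m'          ≡⟨ cong₂ _+_ (outerUnshift-≥ e₂≤p) 2*m'≡g ⟩
    p ∸ g + g                        ≡⟨ m∸n+n≡m (g≤above-gap e₂≤p) ⟩
    p                                ∎
    where
    open ≡-Reasoning
    i<p′ : i < outerUnshift p
    i<p′ = subst (_≤ outerUnshift p) e₁≡1+i (e₁≤outerUnshift e₂≤p)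

  rest-roundtrip : ∀ {d} → d ∈ rest → mapChord (_+ J.i) (mapChord innerUnshift d) ≡ d
  rest-roundtrip d∈ = cong₂ _,_ (roundtrip (inj₁ refl)) (roundtrip (inj₂ refl))
    where
    roundtrip : ∀ {q} → q ∈ᶜ _ → innerUnshift q + J.i ≡ q
    roundtrip {q} q∈d =
      trans (cong (innerUnshift q +_) J-i≡i) (innerShift-innerUnshift (proj₁ (rest-in-gap d∈ q∈d)))

  S-roundtrip : ∀ {s} → s ∈ S → mapChord J.sh (mapChord outerUnshift s) ≡ s
  S-roundtrip s∈ = cong₂ _,_ (outerShift-outerUnshift (∈-endpoints⁺ s∈ (inj₁ refl)))
                             (outerShift-outerUnshift (∈-endpoints⁺ s∈ (inj₂ refl)))

  inner⊆C : ∀ {c} → c ∈ J.NR → mapChord (_+ J.i) c ∈ C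
  inner⊆C {c} c∈ with ∈-nonRoot⁻ J.C' c∈
  ... | c∈C' , c₁≢1 with ∈-map⁻ (mapChord innerUnshift) (∈-resp-↭ θτ'↭ c∈C')
  ...   | _ , here refl , refl = ⊥-elim (c₁≢1 innerUnshift-1)
  ...   | _ , there d∈ , refl  = subst (_∈ C) (sym (rest-roundtrip d∈)) (X⊆C (rest⊆X d∈))

  outer⊆C : ∀ {c} → c ∈ J.C'' → mapChord J.sh c ∈ C
  outer⊆C c∈ with ∈-map⁻ (mapChord outerUnshift) (∈-resp-↭ θτ''↭ c∈)
  ... | s , s∈ , refl = subst (_∈ C) (sym (S-roundtrip s∈)) (X⊆C (S⊆X s∈))

  out⊆C : ∀ {x} → x ∈ J.out → x ∈ C
  out⊆C x∈ with J.∈-out⁻ x∈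
  ... | inj₁ refl                   = subst (λ e → (1 , e) ∈ C) (sym root-end) r∈C
  ... | inj₂ (inj₁ (c , c∈ , refl)) = inner⊆C c∈
  ... | inj₂ (inj₂ (c , c∈ , refl)) = outer⊆C c∈

  C⊆out : ∀ {x} → x ∈ C → x ∈ J.out
  C⊆out x∈ with ∈C⁻ x∈
  ... | inj₁ refl = subst (λ e → (1 , e) ∈ J.out) root-end J.root∈out
  ... | inj₂ x∈X with ∈X⁻ x∈X
  ...   | inj₁ s∈ = subst (_∈ J.out) (S-roundtrip s∈)
                      (J.outer∈out (∈-resp-↭ (↭-sym θτ''↭) (∈-map⁺ (mapChord outerUnshift) s∈)))
  ...   | inj₂ d∈ = subst (_∈ J.out) (rest-roundtrip d∈) (J.inner∈out (∈-nonRoot⁺ J.C'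
                      (∈-resp-↭ (↭-sym θτ'↭) (∈-map⁺ (mapChord innerUnshift) (there d∈)))
                      (>⇒≢ (2≤innerUnshift (proj₁ (rest-in-gap d∈ (inj₁ refl)))))))

  θ-join↭C : θ (join τ' τ'' j) ↭ C
  θ-join↭C = unique-set⇒↭ (Diagram.unique J.out-diagram) unique out⊆C C⊆out
    where open Diagram D using (unique)

  size-join : size (insert t'' (toℕ j) t') ≡ n
  size-join = trans (size-insert t'' (toℕ j) t') (trans (cong₂ _+_ size-t'' size-t') n''+m'≡n)

Preimage : ℕ → List Chord → Set
Preimage n C = ∃ λ t → Σ (Tubing t) λ τ → size t ≡ n × θ τ ↭ C

one-chord : ∀ {C} → DiagramOn 2 C → C ↭ (1 , 2) ∷ []
one-chord {C} D =
  unique-set⇒↭ unique ([] ∷ []) (here ∘ is-root) λ { (here refl) → subst (_∈ C) (is-root r∈) r∈ }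
  where
  open Diagram D
  r∈ : (1 , rootEnd C) ∈ C
  r∈ = root∈ (s≤s z≤n)
  is-root : ∀ {x} → x ∈ C → x ≡ (1 , 2)
  is-root {x} x∈ = cong₂ _,_ x₁≡1 (≤-antisym (end≤ x∈) (subst (_< proj₂ x) x₁≡1 (start<end x∈)))
    where
    x₁≡1 : proj₁ x ≡ 1
    x₁≡1 = ≤-antisym (≤-pred (≤-trans (start<end x∈) (end≤ x∈))) (start≥1 x∈)

θ-surjective : ∀ n {C} → 1 ≤ n → ConnectedDiagramOn (2 * n) C → Preimage n C
θ-surjective = <-rec _ decompose
  where
  decompose : ∀ n → (∀ {m} → m < n → ∀ {C} → 1 ≤ m → ConnectedDiagramOn (2 * m) C → Preimage m C) →
              ∀ {C} → 1 ≤ n → ConnectedDiagramOn (2 * n) C → Preimage n C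
  decompose (suc zero)    _   _ (D , _)    = leaf , single , refl , ↭-sym (one-chord D)
  decompose (suc (suc k)) rec _ (D , conn) = _ , join τ' τ'' R.j , R.size-join , R.θ-join↭C
    where
    module P = Decompose D conn (s≤s (s≤s z≤n))
    inner : Preimage P.m' P.inner₀
    inner = rec P.m'<n P.1≤m'
      (subst (λ L → DiagramOn L P.inner₀) (sym P.2*m'≡g) P.inner₀-diagram , P.inner₀-connected)
    outer : Preimage P.n'' P.outer₀
    outer = rec P.n''<n P.1≤n''
      (subst (λ L → DiagramOn L P.outer₀) (sym P.2*n''≡N'') P.outer₀-diagram , P.outer₀-connected)
    τ' : Tubing (proj₁ inner)
    τ' = proj₁ (proj₂ inner)
    τ'' : Tubing (proj₁ outer)
    τ'' = proj₁ (proj₂ outer)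
    module R = Reassemble D conn (s≤s (s≤s z≤n)) τ' τ''
      (proj₁ (proj₂ (proj₂ inner))) (proj₂ (proj₂ (proj₂ inner)))
      (proj₁ (proj₂ (proj₂ outer))) (proj₂ (proj₂ (proj₂ outer)))

theorem5p16 : (n : ℕ) → 1 ≤ n →
    -- θ maps pairs (t , τ) with |V(t)| = n to rooted connected chord diagrams with n chords
    ((t : PTree) (τ : Tubing t) → size t ≡ n → IsRootedConnectedCD n (θ τ))
    -- injective (chord diagrams compared as sets of chords)
    × ((t₁ t₂ : PTree) (τ₁ : Tubing t₁) (τ₂ : Tubing t₂) → size t₁ ≡ n → size t₂ ≡ n →
         θ τ₁ ↭ θ τ₂ → _≡_ {A = Σ PTree Tubing} (t₁ , τ₁) (t₂ , τ₂))
    -- surjective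
    × ((C : List Chord) → IsRootedConnectedCD n C →
         ∃ λ t → Σ (Tubing t) λ τ → size t ≡ n × θ τ ↭ C)
theorem5p16 n 1≤n = well-defined , injective , surjective
  where
  well-defined : (t : PTree) (τ : Tubing t) → size t ≡ n → IsRootedConnectedCD n (θ τ)
  well-defined t τ refl with θ-connectedDiagram τ
  ... | D , conn = diagramOn⇒isChordDiagram {size t} D , conn
  injective : (t₁ t₂ : PTree) (τ₁ : Tubing t₁) (τ₂ : Tubing t₂) → size t₁ ≡ n → size t₂ ≡ n →
              θ τ₁ ↭ θ τ₂ → _≡_ {A = Σ PTree Tubing} (t₁ , τ₁) (t₂ , τ₂)
  injective _ _ τ₁ τ₂ _ _ = θ-injective τ₁ τ₂
  surjective : (C : List Chord) → IsRootedConnectedCD n C → ∃ λ t → Σ (Tubing t) λ τ → size t ≡ n × θ τ ↭ C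
  surjective C (isCD , conn) = θ-surjective n 1≤n (isChordDiagram⇒diagramOn {n} isCD , conn)
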